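{- Let $H$ and $K$ be finite graphs. Let $G_1=H\cup K$ be formed so that $H$ and $K$ share exactly one vertex, and let $G_2=H\cup K$ be formed so that $H$ and $K$ are vertex-disjoint, so that $E(G_1)=E(G_2)=E(H)\cup E(K)$. Then (1) a set $\mathcal L$ of edge sets is a linear class of bonds of $G_1$ if and only if it is a linear class of bonds of $G_2$; and (2) for such $\mathcal L$, $J_0(G_1,\mathcal L)=J_0(G_2,\mathcal L)$ and $J(G_1,\mathcal L)=J(G_2,\mathcal L)$.
   Context: Graphs are finite, loops and multiple edges allowed. A bond is a minimal nonempty edge cut; $\delta(X)$ is the set of links with exactly one endpoint in a vertex set $X$. A tribond is $\delta(X_1)\cup\delta(X_2)\cup\delta(X_3)$ for a partition $\{X_1,X_2,X_3\}$ of the vertex set of one connected component into nonempty sets with each $G[X_i]$ connected and an edge joining each pair. A linear class of bonds is a set $\mathcal L$ of bonds such that for each such tripartition the number of $i$ with $\delta(X_i)\in\mathcal L$ is never exactly two; $\mathcal L$ is trivial if it contains every bond. A modular pair of bonds $B_1,B_2$ is one for which $G-(B_1\cup B_2)$ has two more components than $G$; a dibond is the union of a modular pair that is not a tribond. For non-trivial $\mathcal L$, $J_0(G,\mathcal L)$ is the matroid on $E(G)\cup\{e_0\}$ whose cocircuits are the bonds in $\mathcal L$, the sets $B\cup\{e_0\}$ for bonds $B\notin\mathcal L$, and the tribonds and dibonds containing no bond of $\mathcal L$; for trivial $\mathcal L$, $J_0(G,\mathcal L)$ is $M(G)$ with $e_0$ added as a loop. $J(G,\mathcal L)=J_0(G,\mathcal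 L)/e_0$. -}

module Defs where

open import Data.Nat using (ℕ; suc; _+_)
open import Data.Fin using (Fin; _↑ˡ_; _↑ʳ_)
open import Data.Fin.Subset using (Subset; _∈_; _∉_; _∪_; _∩_; _⊆_; Nonempty)
  renaming (⊥ to ∅; ⊤ to Full)
open import Data.Bool using (Bool; true; false; _xor_)
open import Data.Vec using (_∷_; tabulate; lookup)
open import Data.Product using (Σ; ∃; ∃₂; _×_; _,_; proj₁; proj₂)
open import Data.Sum using (_⊎_)
open import Relation.Nullary using (¬_)
open import Relation.Binary.PropositionalEquality using (_≡_; _≢_)
open import Function.Bundles using (_⇔_)
open import Function.Definitions using (Injective)

-- A finite graph with vertex set Fin nv and edge set Fin ne.
-- Each edge has two ends (equal ends = loop); parallel edges allowed.
record Graph (nv ne : ℕ) : Set where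
  field
    ends : Fin ne → Fin nv × Fin nv

module _ {nv ne : ℕ} (G : Graph nv ne) where
  open Graph G

  src tgt : Fin ne → Fin nv
  src e = proj₁ (ends e)
  tgt e = proj₂ (ends e)

  -- δ(X): links with exactly one endpoint in X (loops never qualify).
  δ : Subset nv → Subset ne
  δ X = tabulate (λ e → lookup X (src e) xor lookup X (tgt e))

  data Conn (S : Subset nv) (F : Subset ne) : Fin nv → Fin nv → Set where
    here : ∀ {x} → x ∈ S → Conn S F x x
    step : ∀ {x y z} (e : Fin ne) → e ∉ F → x ∈ S →
           ((src e ≡ x × tgt e ≡ z) ⊎ (src e ≡ z × tgt e ≡ x)) →
           Conn S F z y → Conn S F x y

  Connected : Subset nv → Set
  Connected X = Nonempty X × (∀ x y → x ∈ X → y ∈ X → Conn X ∅ x y)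

  Component : Subset nv → Set
  Component C = Connected C × δ C ≡ ∅

  EdgeCut : Subset ne → Set
  EdgeCut D = ∃ λ X → D ≡ δ X

  Bond : Subset ne → Set
  Bond D = EdgeCut D × Nonempty D ×
           (∀ D′ → EdgeCut D′ → Nonempty D′ → D′ ⊆ D → D′ ≡ D)

  Joins : Subset nv → Subset nv → Set
  Joins X Y = ∃ λ e → (src e ∈ X × tgt e ∈ Y) ⊎ (src e ∈ Y × tgt e ∈ X)

  record Tripartition (X₁ X₂ X₃ : Subset nv) : Set where
    field
      comp      : Subset nv
      isComp    : Component comp
      cover     : (X₁ ∪ X₂) ∪ X₃ ≡ comp
      disj₁₂    : X₁ ∩ X₂ ≡ ∅
      disj₁₃    : X₁ ∩ X₃ ≡ ∅
      disj₂₃    : X₂ ∩ X₃ ≡ ∅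
      nonempty₁ : Nonempty X₁
      nonempty₂ : Nonempty X₂
      nonempty₃ : Nonempty X₃
      conn₁     : Connected X₁
      conn₂     : Connected X₂
      conn₃     : Connected X₃
      join₁₂    : Joins X₁ X₂
      join₁₃    : Joins X₁ X₃
      join₂₃    : Joins X₂ X₃

  Tribond : Subset ne → Set
  Tribond T = Σ (Subset nv) λ X₁ → Σ (Subset nv) λ X₂ → Σ (Subset nv) λ X₃ →
              Tripartition X₁ X₂ X₃ × T ≡ (δ X₁ ∪ δ X₂) ∪ δ X₃

  -- G − F has exactly k components: a surjective labelling of the vertices by
  -- Fin k whose classes are exactly the connectivity classes of G − F.
  HasComponents : Subset ne → ℕ → Set
  HasComponents F k = Σ (Fin nv → Fin k) λ c →
    (∀ i → ∃ λ x → c x ≡ i) × (∀ x y → (c x ≡ c y) ⇔ Conn Full F x y)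

  ModularPair : Subset ne → Subset ne → Set
  ModularPair B₁ B₂ = Bond B₁ × Bond B₂ ×
    ∃ λ k → HasComponents ∅ k × HasComponents (B₁ ∪ B₂) (2 + k)

  Dibond : Subset ne → Set
  Dibond D = ∃₂ λ B₁ B₂ → ModularPair B₁ B₂ × D ≡ B₁ ∪ B₂ × ¬ Tribond D

  ExactlyTwo : Set → Set → Set → Set
  ExactlyTwo P Q R = (P × Q × ¬ R) ⊎ (P × ¬ Q × R) ⊎ (¬ P × Q × R)

  LinearClass : (Subset ne → Set) → Set
  LinearClass ℒ = (∀ D → ℒ D → Bond D) ×
    (∀ X₁ X₂ X₃ → Tripartition X₁ X₂ X₃ →
       ¬ ExactlyTwo (ℒ (δ X₁)) (ℒ (δ X₂)) (ℒ (δ X₃)))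

  Trivial : (Subset ne → Set) → Set
  Trivial ℒ = ∀ D → Bond D → ℒ D

  -- Cocircuits of J₀(G,ℒ), a matroid on E(G) ∪ {e₀}, encoded on Fin (suc ne):
  -- position 0 is e₀, position (suc e) is edge e.
  J₀Cocircuit : (Subset ne → Set) → Subset (suc ne) → Set
  J₀Cocircuit ℒ D =
    (Trivial ℒ × (∃ λ B → Bond B × D ≡ false ∷ B))
    ⊎ (¬ Trivial ℒ ×
        ((∃ λ B → ℒ B × D ≡ false ∷ B)
         ⊎ (∃ λ B → Bond B × ¬ ℒ B × D ≡ true ∷ B)
         ⊎ (∃ λ T → (Tribond T ⊎ Dibond T) × (∀ B → ℒ B → ¬ (B ⊆ T))
                    × D ≡ false ∷ T)))

-- Contraction of the element 0: the cocircuits of M/e₀ are the cocircuits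
-- of M not containing e₀.
contract₀ : {n : ℕ} → (Subset (suc n) → Set) → Subset n → Set
contract₀ C D = C (false ∷ D)

JCocircuit : {nv ne : ℕ} → Graph nv ne → (Subset ne → Set) → Subset ne → Set
JCocircuit G ℒ = contract₀ (J₀Cocircuit G ℒ)

mapPair : {A B : Set} → (A → B) → A × A → B × B
mapPair f (x , y) = (f x , f y)

-- G (vertex set Fin p, edge set Fin (m + n)) is H ∪ K: injective vertex maps from
-- H and K covering V(G), with edges of H (resp. K) occupying the first m
-- (resp. last n) edge slots, with the same ends.
record UnionData {a b m n p : ℕ} (H : Graph a m) (K : Graph b n) (G : Graph p (m + n)) : Set where
  field
    fH    : Fin a → Fin p
    fK    : Fin b → Fin p
    injH  : Injective _≡_ _≡_ fH
    injK  : Injective _≡_ _≡_ fK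
    cover : ∀ v → (∃ λ x → fH x ≡ v) ⊎ (∃ λ y → fK y ≡ v)
    endsH : ∀ e → Graph.ends G (e ↑ˡ n) ≡ mapPair fH (Graph.ends H e)
    endsK : ∀ e → Graph.ends G (m ↑ʳ e) ≡ mapPair fK (Graph.ends K e)

record SharedVertexUnion {a b m n p : ℕ} (H : Graph a m) (K : Graph b n) (G : Graph p (m + n)) : Set where
  field
    union  : UnionData H K G
    x₀     : Fin a
    y₀     : Fin b
    shared : UnionData.fH union x₀ ≡ UnionData.fK union y₀
    unique : ∀ x y → UnionData.fH union x ≡ UnionData.fK union y → x ≡ x₀ × y ≡ y₀

record DisjointUnion {a b m n p : ℕ} (H : Graph a m) (K : Graph b n) (G : Graph p (m + n)) : Set where
  field
    union : UnionData H K G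
    disj  : ∀ x y → UnionData.fH union x ≢ UnionData.fK union y

-- Identifying the vertex u of H with the vertex w of K turns the disjoint union G₂ into the
-- one-vertex union G₁: the vertex map φ is injective except on {u, w}, and the function telling
-- H-vertices from K-vertices is constant along edges. Pulling back along φ preserves δ, and a cut
-- of G₂ that separates u from w still gives the same edges after complementing its K-side, so both
-- graphs have the same edge cuts and bonds. A tripartition of G₁ whose last two parts avoid φ u
-- pulls back once its first part is cut down to the side of the other two; a tripartition of G₂
-- with u in its first part pushes forward once the component of w is added to that part. Hence
-- both graphs realise the same triples of cuts, and so have the same tribonds and linear classes.
-- Identifying u with w merges exactly their two components, so G₂ − F always has one component
-- more than G₁ − F; the modular pairs and dibonds, hence the cocircuits of J₀ and of its
-- contraction J, coincide.

module Submission where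

open import Defs
open import Data.Nat using (ℕ; zero; suc; _+_; _<_; z≤n)
import Data.Nat.Properties as ℕ
open import Data.Fin using (Fin; zero; suc; _↑ˡ_; _↑ʳ_; splitAt; punchIn; punchOut)
  renaming (_≟_ to _≟ᶠ_)
import Data.Fin.Properties as Fin
open import Data.Fin.Subset using (Subset; _∈_; _∉_; _∪_; _∩_; _⊆_; Nonempty; ∣_∣; ⁅_⁆)
  renaming (⊥ to ∅; ⊤ to Full)
import Data.Fin.Subset.Properties as Sub
open import Data.Bool.Solver using (module xor-∧-Solver)
open import Data.Bool using (Bool; true; false; _∨_; _∧_; _xor_; not; if_then_else_)
import Data.Bool.Properties as Bool
open import Data.Vec using (Vec; _∷_; lookup; tabulate; zipWith)
import Data.Vec.Properties as Vec
open import Data.Product using (Σ; ∃; _×_; _,_; proj₁; proj₂)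
open import Data.Sum using (_⊎_; inj₁; inj₂; [_,_]′)
import Data.Sum as Sum
open import Data.Empty using (⊥-elim)
open import Relation.Nullary using (¬_; Dec; yes; no; does)
open import Relation.Nullary.Decidable using (_×-dec_; _⊎-dec_; dec-true)
open import Relation.Binary.PropositionalEquality
open import Function.Base using (_∘_)
open import Function.Bundles using (_⇔_; mk⇔; Equivalence)

private
  variable
    n : ℕ

-- Subsets as Boolean vectors

lookup-ext : ∀ {A : Set} {xs ys : Vec A n} → (∀ i → lookup xs i ≡ lookup ys i) → xs ≡ ys
lookup-ext {xs = xs} {ys} h =
  trans (sym (Vec.tabulate∘lookup xs)) (trans (Vec.tabulate-cong h) (Vec.tabulate∘lookup ys))

∈⇒lookup : ∀ {x : Fin n} {p} → x ∈ p → lookup p x ≡ true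
∈⇒lookup = Vec.[]=⇒lookup

lookup⇒∈ : ∀ {x : Fin n} {p} → lookup p x ≡ true → x ∈ p
lookup⇒∈ {x = x} {p = p} = Vec.lookup⇒[]= x p

∉⇒lookup : ∀ {x : Fin n} {p} → x ∉ p → lookup p x ≡ false
∉⇒lookup {x = x} {p = p} x∉p with lookup p x in eq
... | true  = ⊥-elim (x∉p (lookup⇒∈ eq))
... | false = refl

lookup⇒∉ : ∀ {x : Fin n} {p} → lookup p x ≡ false → x ∉ p
lookup⇒∉ eq x∈p with trans (sym (∈⇒lookup x∈p)) eq
... | ()

lookup-∪ : ∀ (p q : Subset n) x → lookup (p ∪ q) x ≡ (lookup p x ∨ lookup q x)
lookup-∪ p q x = Vec.lookup-zipWith _∨_ x p q

lookup-∩ : ∀ (p q : Subset n) x → lookup (p ∩ q) x ≡ (lookup p x ∧ lookup q x)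
lookup-∩ p q x = Vec.lookup-zipWith _∧_ x p q

lookup-∅ : ∀ (x : Fin n) → lookup ∅ x ≡ false
lookup-∅ x = Vec.lookup-replicate x false

lookup-tabulate : ∀ (f : Fin n → Bool) x → lookup (tabulate f) x ≡ f x
lookup-tabulate = Vec.lookup∘tabulate

lookup-≡ : ∀ {m} {x : Fin n} {y : Fin m} {p q} → (x ∈ p → y ∈ q) → (y ∈ q → x ∈ p) →
           lookup p x ≡ lookup q y
lookup-≡ {x = x} {y} {p} {q} p⇒q q⇒p with lookup p x in eqp | lookup q y in eqq
... | true  | true  = refl
... | false | false = refl
... | true  | false = ⊥-elim (lookup⇒∉ eqq (p⇒q (lookup⇒∈ eqp)))
... | false | true  = ⊥-elim (lookup⇒∉ eqp (q⇒p (lookup⇒∈ eqq)))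

disjoint⁺ : ∀ {p q : Subset n} → (∀ {x} → x ∈ p → x ∉ q) → p ∩ q ≡ ∅
disjoint⁺ {p = p} {q} h = Sub.Empty-unique λ (x , x∈p∩q) →
  let x∈p , x∈q = Sub.x∈p∩q⁻ p q x∈p∩q in h x∈p x∈q

disjoint⁻ : ∀ {p q : Subset n} {x} → p ∩ q ≡ ∅ → x ∈ p → x ∉ q
disjoint⁻ eq x∈p x∈q = Sub.∉⊥ (subst (_ ∈_) eq (Sub.x∈p∩q⁺ (x∈p , x∈q)))

disjoint⁻ʳ : ∀ {p q : Subset n} {x} → p ∩ q ≡ ∅ → x ∈ q → x ∉ p
disjoint⁻ʳ eq x∈q x∈p = disjoint⁻ eq x∈p x∈q

disjoint-⊆ˡ : ∀ {p p′ q : Subset n} → p′ ⊆ p → p ∩ q ≡ ∅ → p′ ∩ q ≡ ∅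
disjoint-⊆ˡ p′⊆p eq = disjoint⁺ λ x∈p′ → disjoint⁻ eq (p′⊆p x∈p′)

∈-∪₁ : ∀ {p q r : Subset n} {x} → x ∈ p → x ∈ (p ∪ q) ∪ r
∈-∪₁ {q = q} {r = r} h = Sub.p⊆p∪q r (Sub.p⊆p∪q q h)

∈-∪₂ : ∀ {p q r : Subset n} {x} → x ∈ q → x ∈ (p ∪ q) ∪ r
∈-∪₂ {p = p} {q = q} {r = r} h = Sub.p⊆p∪q r (Sub.q⊆p∪q p q h)

∈-∪₃ : ∀ {p q r : Subset n} {x} → x ∈ r → x ∈ (p ∪ q) ∪ r
∈-∪₃ {p = p} {q = q} {r = r} h = Sub.q⊆p∪q (p ∪ q) r h

∈-∪⁻ : ∀ (p q r : Subset n) {x} → x ∈ (p ∪ q) ∪ r → x ∈ p ⊎ x ∈ q ⊎ x ∈ r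
∈-∪⁻ p q r h with Sub.x∈p∪q⁻ (p ∪ q) r h
... | inj₂ x∈r = inj₂ (inj₂ x∈r)
... | inj₁ x∈p∪q with Sub.x∈p∪q⁻ p q x∈p∪q
...   | inj₁ x∈p = inj₁ x∈p
...   | inj₂ x∈q = inj₂ (inj₁ x∈q)

xor-cancelʳ : ∀ a b c → ((a xor c) xor (b xor c)) ≡ (a xor b)
xor-cancelʳ = solve 3 (λ a b c → (a :+ c) :+ (b :+ c) := a :+ b) refl
  where open xor-∧-Solver

_⊕_ : Subset n → Subset n → Subset n
p ⊕ q = zipWith _xor_ p q

lookup-⊕ : ∀ (p q : Subset n) x → lookup (p ⊕ q) x ≡ (lookup p x xor lookup q x)
lookup-⊕ p q x = Vec.lookup-zipWith _xor_ x p q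

preimage : {a b : ℕ} → (Fin a → Fin b) → Subset b → Subset a
preimage f X = tabulate (λ x → lookup X (f x))

module _ {a b : ℕ} {f : Fin a → Fin b} where

  lookup-preimage : ∀ X x → lookup (preimage f X) x ≡ lookup X (f x)
  lookup-preimage X = lookup-tabulate (λ x → lookup X (f x))

  ∈-preimage⁺ : ∀ {X x} → f x ∈ X → x ∈ preimage f X
  ∈-preimage⁺ {X} {x} h = lookup⇒∈ (trans (lookup-preimage X x) (∈⇒lookup h))

  ∈-preimage⁻ : ∀ {X x} → x ∈ preimage f X → f x ∈ X
  ∈-preimage⁻ {X} {x} h = lookup⇒∈ (trans (sym (lookup-preimage X x)) (∈⇒lookup h))

-- Walks, cuts and components of a graph

HasTripartition : {nv ne : ℕ} → Graph nv ne → Subset ne → Subset ne → Subset ne → Set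
HasTripartition G D₁ D₂ D₃ = Σ (Subset _) λ X₁ → Σ (Subset _) λ X₂ → Σ (Subset _) λ X₃ →
  Tripartition G X₁ X₂ X₃ × δ G X₁ ≡ D₁ × δ G X₂ ≡ D₂ × δ G X₃ ≡ D₃

module Walks {nv ne : ℕ} (G : Graph nv ne) where

  Links : Fin ne → Fin nv → Fin nv → Set
  Links e x z = (src G e ≡ x × tgt G e ≡ z) ⊎ (src G e ≡ z × tgt G e ≡ x)

  Links-sym : ∀ {e x z} → Links e x z → Links e z x
  Links-sym (inj₁ ends) = inj₂ ends
  Links-sym (inj₂ ends) = inj₁ ends

  module _ {S : Subset nv} {F : Subset ne} where

    Conn-start : ∀ {x y} → Conn G S F x y → x ∈ S
    Conn-start (here x∈S)         = x∈S
    Conn-start (step _ _ x∈S _ _) = x∈S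

    Conn-end : ∀ {x y} → Conn G S F x y → y ∈ S
    Conn-end (here y∈S)      = y∈S
    Conn-end (step _ _ _ _ c) = Conn-end c

    Conn-trans : ∀ {x y z} → Conn G S F x y → Conn G S F y z → Conn G S F x z
    Conn-trans (here _)               d = d
    Conn-trans (step e e∉F x∈S ℓ c) d = step e e∉F x∈S ℓ (Conn-trans c d)

    Conn-edge : ∀ {e x z} → e ∉ F → x ∈ S → z ∈ S → Links e x z → Conn G S F x z
    Conn-edge e∉F x∈S z∈S ℓ = step _ e∉F x∈S ℓ (here z∈S)

    Conn-sym : ∀ {x y} → Conn G S F x y → Conn G S F y x
    Conn-sym (here x∈S)             = here x∈S
    Conn-sym (step e e∉F x∈S ℓ c) =
      Conn-trans (Conn-sym c) (Conn-edge e∉F (Conn-start c) x∈S (Links-sym ℓ))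

    Conn-invariant : ∀ {A : Set} (s : Fin nv → A) → (∀ e → s (src G e) ≡ s (tgt G e)) →
                     ∀ {x y} → Conn G S F x y → s x ≡ s y
    Conn-invariant s s-edge (here _) = refl
    Conn-invariant s s-edge (step e _ _ (inj₁ (refl , refl)) c) =
      trans (s-edge e) (Conn-invariant s s-edge c)
    Conn-invariant s s-edge (step e _ _ (inj₂ (refl , refl)) c) =
      trans (sym (s-edge e)) (Conn-invariant s s-edge c)

  Conn-mono : ∀ {S S′ F x y} → S ⊆ S′ → Conn G S F x y → Conn G S′ F x y
  Conn-mono S⊆S′ (here x∈S)           = here (S⊆S′ x∈S)
  Conn-mono S⊆S′ (step e e∉F x∈S ℓ c) = step e e∉F (S⊆S′ x∈S) ℓ (Conn-mono S⊆S′ c)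

  Conn-Full : ∀ {S F x y} → Conn G S F x y → Conn G Full F x y
  Conn-Full = Conn-mono (λ _ → Sub.∈⊤)

  lookup-δ : ∀ X e → lookup (δ G X) e ≡ (lookup X (src G e) xor lookup X (tgt G e))
  lookup-δ X = lookup-tabulate (λ e → lookup X (src G e) xor lookup X (tgt G e))

  Unseparated : Subset nv → Fin ne → Set
  Unseparated X e = lookup X (src G e) ≡ lookup X (tgt G e)

  Closed : Subset nv → Set
  Closed X = ∀ e → Unseparated X e

  δ≡∅⇒Closed : ∀ {X} → δ G X ≡ ∅ → Closed X
  δ≡∅⇒Closed {X} δX≡∅ e = xor≡false⇒≡ _ _ (begin
      lookup X (src G e) xor lookup X (tgt G e) ≡⟨ lookup-δ X e ⟨
      lookup (δ G X) e                          ≡⟨ cong (λ D → lookup D e) δX≡∅ ⟩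
      lookup ∅ e                                ≡⟨ lookup-∅ e ⟩
      false                                     ∎)
    where
    open ≡-Reasoning
    xor≡false⇒≡ : ∀ a b → (a xor b) ≡ false → a ≡ b
    xor≡false⇒≡ true  true  _ = refl
    xor≡false⇒≡ false false _ = refl

  Closed⇒δ≡∅ : ∀ {X} → Closed X → δ G X ≡ ∅
  Closed⇒δ≡∅ {X} closed = lookup-ext λ e → begin
      lookup (δ G X) e                          ≡⟨ lookup-δ X e ⟩
      lookup X (src G e) xor lookup X (tgt G e) ≡⟨ cong (_xor lookup X (tgt G e)) (closed e) ⟩
      lookup X (tgt G e) xor lookup X (tgt G e) ≡⟨ Bool.xor-same (lookup X (tgt G e)) ⟩
      false                                     ≡⟨ lookup-∅ e ⟨
      lookup ∅ e                                ∎
    where open ≡-Reasoning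

  Closed-∩ : ∀ {X Y} → Closed X → Closed Y → Closed (X ∩ Y)
  Closed-∩ {X} {Y} X-closed Y-closed e =
    trans (lookup-∩ X Y (src G e))
          (trans (cong₂ _∧_ (X-closed e) (Y-closed e)) (sym (lookup-∩ X Y (tgt G e))))

  Closed-∪ : ∀ {X Y} → Closed X → Closed Y → Closed (X ∪ Y)
  Closed-∪ {X} {Y} X-closed Y-closed e =
    trans (lookup-∪ X Y (src G e))
          (trans (cong₂ _∨_ (X-closed e) (Y-closed e)) (sym (lookup-∪ X Y (tgt G e))))

  AgreeOnEnds : Subset nv → Subset nv → Fin ne → Set
  AgreeOnEnds A B e =
    lookup A (src G e) ≡ lookup B (src G e) × lookup A (tgt G e) ≡ lookup B (tgt G e)

  δ-edgewise : ∀ {A B} → (∀ e → AgreeOnEnds A B e ⊎ (Unseparated A e × Unseparated B e)) →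
               δ G A ≡ δ G B
  δ-edgewise {A} {B} agree = lookup-ext λ e →
    trans (lookup-δ A e) (trans (on-edge e (agree e)) (sym (lookup-δ B e)))
    where
    on-edge : ∀ e → AgreeOnEnds A B e ⊎ (Unseparated A e × Unseparated B e) →
              (lookup A (src G e) xor lookup A (tgt G e))
                ≡ (lookup B (src G e) xor lookup B (tgt G e))
    on-edge e (inj₁ (s≡ , t≡)) = cong₂ _xor_ s≡ t≡
    on-edge e (inj₂ (A-s≡t , B-s≡t)) = begin
      lookup A (src G e) xor lookup A (tgt G e) ≡⟨ cong (_xor lookup A (tgt G e)) A-s≡t ⟩
      lookup A (tgt G e) xor lookup A (tgt G e) ≡⟨ Bool.xor-same (lookup A (tgt G e)) ⟩
      false                                     ≡⟨ Bool.xor-same (lookup B (tgt G e)) ⟨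
      lookup B (tgt G e) xor lookup B (tgt G e) ≡⟨ cong (_xor lookup B (tgt G e)) B-s≡t ⟨
      lookup B (src G e) xor lookup B (tgt G e) ∎
      where open ≡-Reasoning

  δ-⊕-closed : ∀ X {C} → Closed C → δ G (X ⊕ C) ≡ δ G X
  δ-⊕-closed X {C} closed = lookup-ext on-edge
    where
    on-edge : ∀ e → lookup (δ G (X ⊕ C)) e ≡ lookup (δ G X) e
    on-edge e = begin
      lookup (δ G (X ⊕ C)) e                                ≡⟨ lookup-δ (X ⊕ C) e ⟩
      lookup (X ⊕ C) s xor lookup (X ⊕ C) t                 ≡⟨ cong₂ _xor_ (lookup-⊕ X C s) (lookup-⊕ X C t) ⟩
      (lookup X s xor lookup C s) xor (lookup X t xor lookup C t)
                 ≡⟨ cong (λ c → (lookup X s xor c) xor (lookup X t xor lookup C t)) (closed e) ⟩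
      (lookup X s xor lookup C t) xor (lookup X t xor lookup C t)
                 ≡⟨ xor-cancelʳ (lookup X s) (lookup X t) (lookup C t) ⟩
      lookup X s xor lookup X t                             ≡⟨ lookup-δ X e ⟨
      lookup (δ G X) e                                      ∎
      where
      open ≡-Reasoning
      s t : Fin nv
      s = src G e
      t = tgt G e

  Closed-Links : ∀ {X e x z} → Closed X → Links e x z → x ∈ X → z ∈ X
  Closed-Links {X} {e} closed (inj₁ (refl , refl)) x∈ = lookup⇒∈ (trans (sym (closed e)) (∈⇒lookup x∈))
  Closed-Links {X} {e} closed (inj₂ (refl , refl)) x∈ = lookup⇒∈ (trans (closed e) (∈⇒lookup x∈))

  Closed-Conn : ∀ {X S F x y} → Closed X → x ∈ X → Conn G S F x y → y ∈ X
  Closed-Conn {X} closed x∈X c =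
    lookup⇒∈ (trans (sym (Conn-invariant (lookup X) closed c)) (∈⇒lookup x∈X))

  Conn-restrict : ∀ {S F x y} T → Closed T → x ∈ T → Conn G S F x y → Conn G (S ∩ T) F x y
  Conn-restrict T closed x∈T (here x∈S) = here (Sub.x∈p∩q⁺ (x∈S , x∈T))
  Conn-restrict T closed x∈T (step e e∉F x∈S ℓ c) =
    step e e∉F (Sub.x∈p∩q⁺ (x∈S , x∈T)) ℓ
      (Conn-restrict T closed (Closed-Links closed ℓ x∈T) c)

  Adjacent : Subset nv → Fin nv → Fin ne → Set
  Adjacent R z e = (src G e ∈ R × tgt G e ≡ z) ⊎ (tgt G e ∈ R × src G e ≡ z)

  adjacent? : ∀ R z e → Dec (Adjacent R z e)
  adjacent? R z e =
    ((src G e Sub.∈? R) ×-dec (tgt G e ≟ᶠ z)) ⊎-dec ((tgt G e Sub.∈? R) ×-dec (src G e ≟ᶠ z))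

  grow : Subset nv → Subset nv
  grow R = tabulate (λ z → lookup R z ∨ does (Fin.any? (adjacent? R z)))

  lookup-grow : ∀ R z → lookup (grow R) z ≡ (lookup R z ∨ does (Fin.any? (adjacent? R z)))
  lookup-grow R = lookup-tabulate (λ z → lookup R z ∨ does (Fin.any? (adjacent? R z)))

  ⊆-grow : ∀ {R} → R ⊆ grow R
  ⊆-grow {R} {z} z∈R =
    lookup⇒∈ (trans (lookup-grow R z)
                    (cong (_∨ does (Fin.any? (adjacent? R z))) (∈⇒lookup z∈R)))

  Adjacent⇒∈-grow : ∀ {R z e} → Adjacent R z e → z ∈ grow R
  Adjacent⇒∈-grow {R} {z} {e} adj = lookup⇒∈ (trans (lookup-grow R z)
    (trans (cong (lookup R z ∨_) (dec-true (Fin.any? (adjacent? R z)) (e , adj)))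
           (Bool.∨-zeroʳ (lookup R z))))

  ∈-grow⁻ : ∀ {R z} → z ∈ grow R → z ∈ R ⊎ ∃ (Adjacent R z)
  ∈-grow⁻ {R} {z} z∈ with z Sub.∈? R | Fin.any? (adjacent? R z) in any
  ... | yes z∈R | _      = inj₁ z∈R
  ... | no _    | yes ∃e = inj₂ ∃e
  ... | no z∉R  | no _   = ⊥-elim (lookup⇒∉ (begin
    lookup (grow R) z                               ≡⟨ lookup-grow R z ⟩
    lookup R z ∨ does (Fin.any? (adjacent? R z))    ≡⟨ cong₂ _∨_ (∉⇒lookup z∉R) (cong does any) ⟩
    false                                           ∎) z∈)
    where open ≡-Reasoning

  grow-stable-or-larger : ∀ R → grow R ≡ R ⊎ ∣ R ∣ < ∣ grow R ∣
  grow-stable-or-larger R with R Sub.⊂? grow R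
  ... | yes R⊂grow = inj₂ (Sub.p⊂q⇒∣p∣<∣q∣ R⊂grow)
  ... | no R⊄grow  = inj₁ (Sub.⊆-antisym grow⊆R ⊆-grow)
    where
    grow⊆R : grow R ⊆ R
    grow⊆R {z} z∈ with z Sub.∈? R
    ... | yes z∈R = z∈R
    ... | no z∉R  = ⊥-elim (R⊄grow (⊆-grow , z , z∈ , z∉R))

  module ComponentOf (t : Fin nv) where

    ball : ℕ → Subset nv
    ball zero    = ⁅ t ⁆
    ball (suc k) = grow (ball k)

    ball-stable-or-large : ∀ k → ball (suc k) ≡ ball k ⊎ k < ∣ ball (suc k) ∣
    ball-stable-or-large zero with grow-stable-or-larger (ball zero)
    ... | inj₁ stable = inj₁ stable
    ... | inj₂ larger = inj₂ (ℕ.≤-<-trans z≤n larger)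
    ball-stable-or-large (suc k) with ball-stable-or-large k
    ... | inj₁ stable = inj₁ (cong grow stable)
    ... | inj₂ large with grow-stable-or-larger (ball (suc k))
    ...   | inj₁ stable = inj₁ stable
    ...   | inj₂ larger = inj₂ (ℕ.≤-<-trans large larger)

    vertices : Subset nv
    vertices = ball nv

    -- a ball that is not stable is larger than its radius, so radius nv is stable
    grow-vertices : grow vertices ≡ vertices
    grow-vertices with ball-stable-or-large nv
    ... | inj₁ stable = stable
    ... | inj₂ large  = ⊥-elim (ℕ.<⇒≱ large (Sub.∣p∣≤n (ball (suc nv))))

    t∈ball : ∀ k → t ∈ ball k
    t∈ball zero    = Sub.x∈⁅x⁆ t
    t∈ball (suc k) = ⊆-grow (t∈ball k)

    ∈-ball⇒Conn : ∀ k {y} → y ∈ ball k → Conn G Full ∅ t y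
    ∈-ball⇒Conn zero y∈ rewrite Sub.x∈⁅y⁆⇒x≡y t y∈ = here Sub.∈⊤
    ∈-ball⇒Conn (suc k) y∈ with ∈-grow⁻ y∈
    ... | inj₁ y∈ball = ∈-ball⇒Conn k y∈ball
    ... | inj₂ (e , inj₁ (s∈ , refl)) =
      Conn-trans (∈-ball⇒Conn k s∈) (Conn-edge Sub.∉⊥ Sub.∈⊤ Sub.∈⊤ (inj₁ (refl , refl)))
    ... | inj₂ (e , inj₂ (t∈ , refl)) =
      Conn-trans (∈-ball⇒Conn k t∈) (Conn-edge Sub.∉⊥ Sub.∈⊤ Sub.∈⊤ (inj₂ (refl , refl)))

    ∈⇒Conn : ∀ {y} → y ∈ vertices → Conn G Full ∅ t y
    ∈⇒Conn = ∈-ball⇒Conn nv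

    t∈vertices : t ∈ vertices
    t∈vertices = t∈ball nv

    closed : Closed vertices
    closed e = lookup-≡ (λ s∈ → stable (inj₁ (s∈ , refl))) (λ t∈ → stable (inj₂ (t∈ , refl)))
      where
      stable : ∀ {z} → Adjacent vertices z e → z ∈ vertices
      stable adj = subst (_ ∈_) grow-vertices (Adjacent⇒∈-grow adj)

    Conn⇒∈ : ∀ {y} → Conn G Full ∅ t y → y ∈ vertices
    Conn⇒∈ = Closed-Conn closed t∈vertices

    Conn-inside : ∀ {x y} → Conn G Full ∅ t x → Conn G Full ∅ x y → Conn G vertices ∅ x y
    Conn-inside tx (here _) = here (Conn⇒∈ tx)
    Conn-inside tx (step e e∉ _ ℓ c) =
      step e e∉ (Conn⇒∈ tx) ℓ (Conn-inside (Conn-trans tx (Conn-edge e∉ Sub.∈⊤ Sub.∈⊤ ℓ)) c)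

    connected : Connected G vertices
    connected = (t , t∈vertices) , λ x y x∈ y∈ →
      Conn-trans (Conn-inside (∈⇒Conn x∈) (Conn-sym (∈⇒Conn x∈)))
                 (Conn-inside (here Sub.∈⊤) (∈⇒Conn y∈))

    isComponent : Component G vertices
    isComponent = connected , Closed⇒δ≡∅ {vertices} closed

  Joins-nonemptyˡ : ∀ {X Y} → Joins G X Y → Nonempty X
  Joins-nonemptyˡ (e , inj₁ (s∈X , _)) = src G e , s∈X
  Joins-nonemptyˡ (e , inj₂ (_ , t∈X)) = tgt G e , t∈X

  Joins-sym : ∀ {X Y} → Joins G X Y → Joins G Y X
  Joins-sym (e , inj₁ ends) = e , inj₂ ends
  Joins-sym (e , inj₂ ends) = e , inj₁ ends

  Tripartition-swap₁₂ : ∀ {X₁ X₂ X₃} → Tripartition G X₁ X₂ X₃ → Tripartition G X₂ X₁ X₃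
  Tripartition-swap₁₂ {X₁} {X₂} {X₃} T = record
    { comp = comp ; isComp = isComp
    ; cover = trans (cong (_∪ X₃) (Sub.∪-comm X₂ X₁)) cover
    ; disj₁₂ = trans (Sub.∩-comm X₂ X₁) disj₁₂ ; disj₁₃ = disj₂₃ ; disj₂₃ = disj₁₃
    ; nonempty₁ = nonempty₂ ; nonempty₂ = nonempty₁ ; nonempty₃ = nonempty₃
    ; conn₁ = conn₂ ; conn₂ = conn₁ ; conn₃ = conn₃
    ; join₁₂ = Joins-sym join₁₂ ; join₁₃ = join₂₃ ; join₂₃ = join₁₃ }
    where open Tripartition T

  Tripartition-swap₂₃ : ∀ {X₁ X₂ X₃} → Tripartition G X₁ X₂ X₃ → Tripartition G X₁ X₃ X₂
  Tripartition-swap₂₃ {X₁} {X₂} {X₃} T = record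
    { comp = comp ; isComp = isComp
    ; cover = begin
        (X₁ ∪ X₃) ∪ X₂ ≡⟨ Sub.∪-assoc X₁ X₃ X₂ ⟩
        X₁ ∪ (X₃ ∪ X₂) ≡⟨ cong (X₁ ∪_) (Sub.∪-comm X₃ X₂) ⟩
        X₁ ∪ (X₂ ∪ X₃) ≡⟨ Sub.∪-assoc X₁ X₂ X₃ ⟨
        (X₁ ∪ X₂) ∪ X₃ ≡⟨ cover ⟩
        comp           ∎
    ; disj₁₂ = disj₁₃ ; disj₁₃ = disj₁₂ ; disj₂₃ = trans (Sub.∩-comm X₃ X₂) disj₂₃
    ; nonempty₁ = nonempty₁ ; nonempty₂ = nonempty₃ ; nonempty₃ = nonempty₂
    ; conn₁ = conn₁ ; conn₂ = conn₃ ; conn₃ = conn₂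
    ; join₁₂ = join₁₃ ; join₁₃ = join₁₂ ; join₂₃ = Joins-sym join₂₃ }
    where
    open Tripartition T
    open ≡-Reasoning

  HasTripartition-swap₁₂ : ∀ {D₁ D₂ D₃} → HasTripartition G D₁ D₂ D₃ → HasTripartition G D₂ D₁ D₃
  HasTripartition-swap₁₂ (X₁ , X₂ , X₃ , T , δ₁ , δ₂ , δ₃) =
    X₂ , X₁ , X₃ , Tripartition-swap₁₂ T , δ₂ , δ₁ , δ₃

  HasTripartition-rotate : ∀ {D₁ D₂ D₃} → HasTripartition G D₁ D₂ D₃ → HasTripartition G D₂ D₃ D₁
  HasTripartition-rotate (X₁ , X₂ , X₃ , T , δ₁ , δ₂ , δ₃) =
    X₂ , X₃ , X₁ , Tripartition-swap₂₃ (Tripartition-swap₁₂ T) , δ₂ , δ₃ , δ₁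

  ∈-comp₁ : ∀ {X₁ X₂ X₃} (T : Tripartition G X₁ X₂ X₃) → X₁ ⊆ Tripartition.comp T
  ∈-comp₁ T x∈ = subst (_ ∈_) (Tripartition.cover T) (∈-∪₁ x∈)

  ∈-comp₂ : ∀ {X₁ X₂ X₃} (T : Tripartition G X₁ X₂ X₃) → X₂ ⊆ Tripartition.comp T
  ∈-comp₂ T x∈ = subst (_ ∈_) (Tripartition.cover T) (∈-∪₂ x∈)

  ∈-comp₃ : ∀ {X₁ X₂ X₃} (T : Tripartition G X₁ X₂ X₃) → X₃ ⊆ Tripartition.comp T
  ∈-comp₃ T x∈ = subst (_ ∈_) (Tripartition.cover T) (∈-∪₃ x∈)

  ∈-comp⁻ : ∀ {X₁ X₂ X₃} (T : Tripartition G X₁ X₂ X₃) {x} →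
            x ∈ Tripartition.comp T → x ∈ X₁ ⊎ x ∈ X₂ ⊎ x ∈ X₃
  ∈-comp⁻ {X₁} {X₂} {X₃} T x∈ = ∈-∪⁻ X₁ X₂ X₃ (subst (_ ∈_) (sym (Tripartition.cover T)) x∈)

-- Graphs on the same edges with the same bonds and tripartition cuts

TripartitionsRealizedIn : {nv nv′ ne : ℕ} → Graph nv ne → Graph nv′ ne → Set
TripartitionsRealizedIn G G′ =
  ∀ {X₁ X₂ X₃} → Tripartition G X₁ X₂ X₃ → HasTripartition G′ (δ G X₁) (δ G X₂) (δ G X₃)

module _ {nv nv′ ne : ℕ} {G : Graph nv ne} {G′ : Graph nv′ ne} where

  open Walks G using (∈-comp⁻; Tripartition-swap₁₂; Tripartition-swap₂₃)
  open Walks G′ using (HasTripartition-swap₁₂; HasTripartition-rotate)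

  realize-wlog₁ : ∀ {t} →
    (∀ {X₁ X₂ X₃} (T : Tripartition G X₁ X₂ X₃) → t ∈ X₁ →
       HasTripartition G′ (δ G X₁) (δ G X₂) (δ G X₃)) →
    ∀ {X₁ X₂ X₃} (T : Tripartition G X₁ X₂ X₃) → t ∈ Tripartition.comp T →
    HasTripartition G′ (δ G X₁) (δ G X₂) (δ G X₃)
  realize-wlog₁ build T t∈comp with ∈-comp⁻ T t∈comp
  ... | inj₁ t∈X₁          = build T t∈X₁
  ... | inj₂ (inj₁ t∈X₂) = HasTripartition-swap₁₂ (build (Tripartition-swap₁₂ T) t∈X₂)
  ... | inj₂ (inj₂ t∈X₃) =
    HasTripartition-rotate (build (Tripartition-swap₁₂ (Tripartition-swap₂₃ T)) t∈X₃)

  Tribond-transfer : TripartitionsRealizedIn G G′ → ∀ {D} → Tribond G D → Tribond G′ D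
  Tribond-transfer realize (X₁ , X₂ , X₃ , T , D≡) with realize T
  ... | Y₁ , Y₂ , Y₃ , T′ , δ₁ , δ₂ , δ₃ =
    Y₁ , Y₂ , Y₃ , T′ , trans D≡ (sym (cong₂ _∪_ (cong₂ _∪_ δ₁ δ₂) δ₃))

  LinearClass-transfer : ∀ {ℒ} → (∀ {D} → Bond G D → Bond G′ D) → TripartitionsRealizedIn G′ G →
                         LinearClass G ℒ → LinearClass G′ ℒ
  LinearClass-transfer {ℒ} bond realize (ℒ⊆bonds , not-two) =
    (λ D ℒD → bond (ℒ⊆bonds D ℒD)) , λ _ _ _ T → realized (realize T)
    where
    realized : ∀ {D₁ D₂ D₃} → HasTripartition G D₁ D₂ D₃ → ¬ ExactlyTwo G′ (ℒ D₁) (ℒ D₂) (ℒ D₃)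
    realized (Y₁ , Y₂ , Y₃ , T , refl , refl , refl) = not-two Y₁ Y₂ Y₃ T

  Trivial-transfer : ∀ {ℒ} → (∀ {D} → Bond G′ D → Bond G D) → Trivial G ℒ → Trivial G′ ℒ
  Trivial-transfer bond⁻ triv D isBond = triv D (bond⁻ isBond)

  ¬Trivial-transfer : ∀ {ℒ} → (∀ {D} → Bond G D → Bond G′ D) → ¬ Trivial G ℒ → ¬ Trivial G′ ℒ
  ¬Trivial-transfer bond ¬triv triv′ = ¬triv λ D isBond → triv′ D (bond isBond)

  Dibond-transfer : (∀ {B₁ B₂} → ModularPair G B₁ B₂ → ModularPair G′ B₁ B₂) →
                    (∀ {D} → Tribond G′ D → Tribond G D) → ∀ {D} → Dibond G D → Dibond G′ D
  Dibond-transfer modular tribond⁻ (B₁ , B₂ , mp , D≡ , ¬tribond) =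
    B₁ , B₂ , modular mp , D≡ , ¬tribond ∘ tribond⁻

  J₀Cocircuit-transfer : ∀ {ℒ} →
    (∀ {D} → Bond G D → Bond G′ D) → (∀ {D} → Bond G′ D → Bond G D) →
    TripartitionsRealizedIn G G′ → (∀ {D} → Dibond G D → Dibond G′ D) →
    ∀ {D} → J₀Cocircuit G ℒ D → J₀Cocircuit G′ ℒ D
  J₀Cocircuit-transfer bond bond⁻ _ _ (inj₁ (triv , B , isBond , D≡)) =
    inj₁ (Trivial-transfer bond⁻ triv , B , bond isBond , D≡)
  J₀Cocircuit-transfer bond _ _ _ (inj₂ (¬triv , inj₁ inℒ)) =
    inj₂ (¬Trivial-transfer bond ¬triv , inj₁ inℒ)
  J₀Cocircuit-transfer bond _ _ _ (inj₂ (¬triv , inj₂ (inj₁ (B , isBond , ∉ℒ , D≡)))) =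
    inj₂ (¬Trivial-transfer bond ¬triv , inj₂ (inj₁ (B , bond isBond , ∉ℒ , D≡)))
  J₀Cocircuit-transfer bond _ realize dibond (inj₂ (¬triv , inj₂ (inj₂ (T , kind , ℒ⊈T , D≡)))) =
    inj₂ (¬Trivial-transfer bond ¬triv ,
          inj₂ (inj₂ (T , Sum.map (Tribond-transfer realize) dibond kind , ℒ⊈T , D≡)))

-- Identifying two vertices

-- G₁ is G₂ with the vertices u and w identified by φ (ψ picks preimages), and the
-- edge-invariant side function separates u from w.
record Identification {q p ne : ℕ} (G₂ : Graph q ne) (G₁ : Graph p ne) : Set where
  field
    φ      : Fin q → Fin p
    ψ      : Fin p → Fin q
    u w    : Fin q
    side   : Fin q → Bool
    src-φ  : ∀ e → src G₁ e ≡ φ (src G₂ e)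
    tgt-φ  : ∀ e → tgt G₁ e ≡ φ (tgt G₂ e)
    φ∘ψ    : ∀ v → φ (ψ v) ≡ v
    φ-identifies : ∀ x y → φ x ≡ φ y → x ≡ y ⊎ (x ≡ u × y ≡ w) ⊎ (x ≡ w × y ≡ u)
    φu≡φw  : φ u ≡ φ w
    side-edge : ∀ e → side (src G₂ e) ≡ side (tgt G₂ e)
    side-u : side u ≡ true
    side-w : side w ≡ false

Identification-swap : ∀ {q p ne} {G₂ : Graph q ne} {G₁ : Graph p ne} →
                      Identification G₂ G₁ → Identification G₂ G₁
Identification-swap I = record
  { φ = φ ; ψ = ψ ; u = w ; w = u ; side = not ∘ side
  ; src-φ = src-φ ; tgt-φ = tgt-φ ; φ∘ψ = φ∘ψ
  ; φ-identifies = λ x y eq → swap-ends (φ-identifies x y eq)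
  ; φu≡φw = sym φu≡φw ; side-edge = λ e → cong not (side-edge e)
  ; side-u = cong not side-w ; side-w = cong not side-u }
  where
  open Identification I
  swap-ends : ∀ {x y} → x ≡ y ⊎ (x ≡ u × y ≡ w) ⊎ (x ≡ w × y ≡ u) →
                        x ≡ y ⊎ (x ≡ w × y ≡ u) ⊎ (x ≡ u × y ≡ w)
  swap-ends (inj₁ x≡y)        = inj₁ x≡y
  swap-ends (inj₂ (inj₁ uw)) = inj₂ (inj₂ uw)
  swap-ends (inj₂ (inj₂ wu)) = inj₂ (inj₁ wu)

module Identified {q p ne : ℕ} {G₂ : Graph q ne} {G₁ : Graph p ne} (I : Identification G₂ G₁) where
  open Identification I
  module W₂ = Walks G₂
  module W₁ = Walks G₁

  φ⁻¹[_] : Subset p → Subset q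
  φ⁻¹[ X ] = preimage φ X

  lookup-φ⁻¹ : ∀ X x → lookup φ⁻¹[ X ] x ≡ lookup X (φ x)
  lookup-φ⁻¹ = lookup-preimage {f = φ}

  -- the image of Z under φ, provided Z is saturated
  φ[_] : Subset q → Subset p
  φ[ Z ] = preimage ψ Z

  lookup-φ[] : ∀ Z v → lookup φ[ Z ] v ≡ lookup Z (ψ v)
  lookup-φ[] = lookup-preimage {f = ψ}

  Saturated : Subset q → Set
  Saturated Z = lookup Z u ≡ lookup Z w

  lookup-ψφ : ∀ {Z} → Saturated Z → ∀ x → lookup Z (ψ (φ x)) ≡ lookup Z x
  lookup-ψφ {Z} sat x with φ-identifies (ψ (φ x)) x (φ∘ψ (φ x))
  ... | inj₁ eq               = cong (lookup Z) eq
  ... | inj₂ (inj₁ (refl , refl)) = sat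
  ... | inj₂ (inj₂ (refl , refl)) = sym sat

  φ⁻¹φ : ∀ {Z} → Saturated Z → φ⁻¹[ φ[ Z ] ] ≡ Z
  φ⁻¹φ {Z} sat = lookup-ext λ x →
    trans (lookup-φ⁻¹ φ[ Z ] x) (trans (lookup-φ[] Z (φ x)) (lookup-ψφ {Z} sat x))

  ∈-φ[]⁺ : ∀ {Z x} → Saturated Z → x ∈ Z → φ x ∈ φ[ Z ]
  ∈-φ[]⁺ {Z} {x} sat x∈Z =
    lookup⇒∈ (trans (lookup-φ[] Z (φ x)) (trans (lookup-ψφ {Z} sat x) (∈⇒lookup x∈Z)))

  ∈-φ[]⁻ : ∀ {Z v} → v ∈ φ[ Z ] → ψ v ∈ Z
  ∈-φ[]⁻ = ∈-preimage⁻ {f = ψ}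

  δ-φ⁻¹ : ∀ X → δ G₁ X ≡ δ G₂ φ⁻¹[ X ]
  δ-φ⁻¹ X = lookup-ext on-edge
    where
    on-edge : ∀ e → lookup (δ G₁ X) e ≡ lookup (δ G₂ φ⁻¹[ X ]) e
    on-edge e = begin
      lookup (δ G₁ X) e                                  ≡⟨ W₁.lookup-δ X e ⟩
      lookup X (src G₁ e) xor lookup X (tgt G₁ e)        ≡⟨ cong₂ (λ a b → lookup X a xor lookup X b)
                                                                 (src-φ e) (tgt-φ e) ⟩
      lookup X (φ s) xor lookup X (φ t)                  ≡⟨ cong₂ _xor_ (lookup-φ⁻¹ X s) (lookup-φ⁻¹ X t) ⟨
      lookup φ⁻¹[ X ] s xor lookup φ⁻¹[ X ] t            ≡⟨ W₂.lookup-δ φ⁻¹[ X ] e ⟨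
      lookup (δ G₂ φ⁻¹[ X ]) e                           ∎
      where
      open ≡-Reasoning
      s t : Fin q
      s = src G₂ e
      t = tgt G₂ e

  δ-φ[] : ∀ {Z} → Saturated Z → δ G₁ φ[ Z ] ≡ δ G₂ Z
  δ-φ[] {Z} sat = trans (δ-φ⁻¹ φ[ Z ]) (cong (δ G₂) (φ⁻¹φ {Z} sat))

  onSide : Bool → Subset q
  onSide σ = tabulate (λ x → does (side x Bool.≟ σ))

  lookup-onSide : ∀ σ x → lookup (onSide σ) x ≡ does (side x Bool.≟ σ)
  lookup-onSide σ = lookup-tabulate (λ x → does (side x Bool.≟ σ))

  onSide-closed : ∀ σ → W₂.Closed (onSide σ)
  onSide-closed σ e = trans (lookup-onSide σ (src G₂ e))
    (trans (cong (λ s → does (s Bool.≟ σ)) (side-edge e)) (sym (lookup-onSide σ (tgt G₂ e))))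

  realign : Subset q → Subset q
  realign X with lookup X u Bool.≟ lookup X w
  ... | yes _ = X
  ... | no _  = X ⊕ onSide false

  δ-realign : ∀ X → δ G₂ (realign X) ≡ δ G₂ X
  δ-realign X with lookup X u Bool.≟ lookup X w
  ... | yes _ = refl
  ... | no _  = W₂.δ-⊕-closed X (onSide-closed false)

  realign-saturated : ∀ X → Saturated (realign X)
  realign-saturated X with lookup X u Bool.≟ lookup X w
  ... | yes Xu≡Xw = Xu≡Xw
  ... | no Xu≢Xw  = begin
    lookup (X ⊕ onSide false) u                         ≡⟨ lookup-⊕ X (onSide false) u ⟩
    lookup X u xor lookup (onSide false) u              ≡⟨ cong (lookup X u xor_) u-off ⟩
    lookup X u xor false                                ≡⟨ Bool.xor-identityʳ (lookup X u) ⟩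
    lookup X u                                          ≡⟨ ≢⇒≡not Xu≢Xw ⟩
    not (lookup X w)                                    ≡⟨ Bool.xor-comm true (lookup X w) ⟩
    lookup X w xor true                                 ≡⟨ cong (lookup X w xor_) w-on ⟨
    lookup X w xor lookup (onSide false) w              ≡⟨ lookup-⊕ X (onSide false) w ⟨
    lookup (X ⊕ onSide false) w                         ∎
    where
    open ≡-Reasoning
    u-off : lookup (onSide false) u ≡ false
    u-off = trans (lookup-onSide false u) (cong (λ s → does (s Bool.≟ false)) side-u)
    w-on : lookup (onSide false) w ≡ true
    w-on = trans (lookup-onSide false w) (cong (λ s → does (s Bool.≟ false)) side-w)
    ≢⇒≡not : ∀ {a b} → a ≢ b → a ≡ not b
    ≢⇒≡not {true}  {true}  a≢b = ⊥-elim (a≢b refl)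
    ≢⇒≡not {true}  {false} _   = refl
    ≢⇒≡not {false} {true}  _   = refl
    ≢⇒≡not {false} {false} a≢b = ⊥-elim (a≢b refl)

  EdgeCut₁⇒₂ : ∀ {D} → EdgeCut G₁ D → EdgeCut G₂ D
  EdgeCut₁⇒₂ (X , D≡δX) = φ⁻¹[ X ] , trans D≡δX (δ-φ⁻¹ X)

  EdgeCut₂⇒₁ : ∀ {D} → EdgeCut G₂ D → EdgeCut G₁ D
  EdgeCut₂⇒₁ (X , D≡δX) = φ[ realign X ] , (begin
    _                        ≡⟨ D≡δX ⟩
    δ G₂ X                   ≡⟨ δ-realign X ⟨
    δ G₂ (realign X)         ≡⟨ δ-φ[] {realign X} (realign-saturated X) ⟨
    δ G₁ φ[ realign X ]      ∎)
    where open ≡-Reasoning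

  Bond₁⇒₂ : ∀ {D} → Bond G₁ D → Bond G₂ D
  Bond₁⇒₂ (cut , nonempty , minimal) =
    EdgeCut₁⇒₂ cut , nonempty , λ D′ cut′ → minimal D′ (EdgeCut₂⇒₁ cut′)

  Bond₂⇒₁ : ∀ {D} → Bond G₂ D → Bond G₁ D
  Bond₂⇒₁ (cut , nonempty , minimal) =
    EdgeCut₂⇒₁ cut , nonempty , λ D′ cut′ → minimal D′ (EdgeCut₁⇒₂ cut′)

  Links-φ : ∀ {e x z} → W₂.Links e x z → W₁.Links e (φ x) (φ z)
  Links-φ {e} (inj₁ (refl , refl)) = inj₁ (src-φ e , tgt-φ e)
  Links-φ {e} (inj₂ (refl , refl)) = inj₂ (src-φ e , tgt-φ e)

  Conn-φ : ∀ {S S′ F x y} → (∀ {z} → z ∈ S → φ z ∈ S′) → Conn G₂ S F x y → Conn G₁ S′ F (φ x) (φ y)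
  Conn-φ S→S′ (here x∈S)           = here (S→S′ x∈S)
  Conn-φ S→S′ (step e e∉F x∈S ℓ c) = step e e∉F (S→S′ x∈S) (Links-φ ℓ) (Conn-φ S→S′ c)

  Conn-side : ∀ {S F x y} → Conn G₂ S F x y → side x ≡ side y
  Conn-side = W₂.Conn-invariant side side-edge

  -- what a walk of G₁ lifts to: a walk of G₂ that may jump once between u and w
  ConnModulo : Subset q → Subset ne → Fin q → Fin q → Set
  ConnModulo S F x y = Conn G₂ S F x y
                     ⊎ (Conn G₂ S F x u × Conn G₂ S F w y)
                     ⊎ (Conn G₂ S F x w × Conn G₂ S F u y)

  ∈-φ⁻¹⁺ : ∀ {S x a} → φ x ≡ a → a ∈ S → x ∈ φ⁻¹[ S ]
  ∈-φ⁻¹⁺ refl = ∈-preimage⁺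

  ∈-φ⁻¹⁻ : ∀ {S x} → x ∈ φ⁻¹[ S ] → φ x ∈ S
  ∈-φ⁻¹⁻ = ∈-preimage⁻ {f = φ}

  ConnModulo-identify : ∀ {S F x s y} → φ x ≡ φ s → x ∈ S → ConnModulo S F s y → ConnModulo S F x y
  ConnModulo-identify {x = x} {s} φx≡φs x∈S c with φ-identifies x s φx≡φs
  ... | inj₁ refl = c
  ConnModulo-identify _ x∈S (inj₁ c)                | inj₂ (inj₁ (refl , refl)) = inj₂ (inj₁ (here x∈S , c))
  ConnModulo-identify _ x∈S (inj₂ (inj₁ (_ , c)))   | inj₂ (inj₁ (refl , refl)) = inj₂ (inj₁ (here x∈S , c))
  ConnModulo-identify _ x∈S (inj₂ (inj₂ (_ , c)))   | inj₂ (inj₁ (refl , refl)) = inj₁ c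
  ConnModulo-identify _ x∈S (inj₁ c)                | inj₂ (inj₂ (refl , refl)) = inj₂ (inj₂ (here x∈S , c))
  ConnModulo-identify _ x∈S (inj₂ (inj₁ (_ , c)))   | inj₂ (inj₂ (refl , refl)) = inj₁ c
  ConnModulo-identify _ x∈S (inj₂ (inj₂ (_ , c)))   | inj₂ (inj₂ (refl , refl)) = inj₂ (inj₂ (here x∈S , c))

  ConnModulo-step : ∀ {S F s t y e} → e ∉ F → s ∈ S → W₂.Links e s t →
                    ConnModulo S F t y → ConnModulo S F s y
  ConnModulo-step e∉F s∈S ℓ (inj₁ c)               = inj₁ (step _ e∉F s∈S ℓ c)
  ConnModulo-step e∉F s∈S ℓ (inj₂ (inj₁ (c , c′))) = inj₂ (inj₁ (step _ e∉F s∈S ℓ c , c′))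
  ConnModulo-step e∉F s∈S ℓ (inj₂ (inj₂ (c , c′))) = inj₂ (inj₂ (step _ e∉F s∈S ℓ c , c′))

  Conn-lift : ∀ {S F a b} → Conn G₁ S F a b → ∀ x y → φ x ≡ a → φ y ≡ b →
              ConnModulo φ⁻¹[ S ] F x y
  Conn-lift (here a∈S) x y φx≡a φy≡a with φ-identifies x y (trans φx≡a (sym φy≡a))
  ... | inj₁ refl                 = inj₁ (here (∈-φ⁻¹⁺ φx≡a a∈S))
  ... | inj₂ (inj₁ (refl , refl)) = inj₂ (inj₁ (here (∈-φ⁻¹⁺ φx≡a a∈S) , here (∈-φ⁻¹⁺ φy≡a a∈S)))
  ... | inj₂ (inj₂ (refl , refl)) = inj₂ (inj₂ (here (∈-φ⁻¹⁺ φx≡a a∈S) , here (∈-φ⁻¹⁺ φy≡a a∈S)))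
  Conn-lift {a = a} (step e e∉F a∈S (inj₁ (src≡a , tgt≡z)) c) x y φx≡a φy≡b =
    ConnModulo-identify (trans φx≡a (sym φs≡a)) (∈-φ⁻¹⁺ φx≡a a∈S)
      (ConnModulo-step e∉F (∈-φ⁻¹⁺ φs≡a a∈S) (inj₁ (refl , refl))
        (Conn-lift c (tgt G₂ e) y (trans (sym (tgt-φ e)) tgt≡z) φy≡b))
    where
    φs≡a : φ (src G₂ e) ≡ a
    φs≡a = trans (sym (src-φ e)) src≡a
  Conn-lift {a = a} (step e e∉F a∈S (inj₂ (src≡z , tgt≡a)) c) x y φx≡a φy≡b =
    ConnModulo-identify (trans φx≡a (sym φt≡a)) (∈-φ⁻¹⁺ φx≡a a∈S)
      (ConnModulo-step e∉F (∈-φ⁻¹⁺ φt≡a a∈S) (inj₂ (refl , refl))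
        (Conn-lift c (src G₂ e) y (trans (sym (src-φ e)) src≡z) φy≡b))
    where
    φt≡a : φ (tgt G₂ e) ≡ a
    φt≡a = trans (sym (tgt-φ e)) tgt≡a

  Conn-lift-avoiding : ∀ {S F x y} → φ u ∉ S → Conn G₁ S F (φ x) (φ y) → Conn G₂ φ⁻¹[ S ] F x y
  Conn-lift-avoiding {x = x} {y} φu∉S c with Conn-lift c x y refl refl
  ... | inj₁ c′              = c′
  ... | inj₂ (inj₁ (c₁ , _)) = ⊥-elim (φu∉S (∈-φ⁻¹⁻ (W₂.Conn-end c₁)))
  ... | inj₂ (inj₂ (_ , c₂)) = ⊥-elim (φu∉S (∈-φ⁻¹⁻ (W₂.Conn-start c₂)))

  side-u≢side-w : side u ≢ side w
  side-u≢side-w eq with trans (sym side-u) (trans eq side-w)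
  ... | ()

  Conn-lift-same-side : ∀ {S F x y} → side x ≡ side y → Conn G₁ S F (φ x) (φ y) → Conn G₂ φ⁻¹[ S ] F x y
  Conn-lift-same-side {x = x} {y} sx≡sy c with Conn-lift c x y refl refl
  ... | inj₁ c′               = c′
  ... | inj₂ (inj₁ (c₁ , c₂)) = ⊥-elim (side-u≢side-w
          (trans (sym (Conn-side c₁)) (trans sx≡sy (sym (Conn-side c₂)))))
  ... | inj₂ (inj₂ (c₁ , c₂)) = ⊥-elim (side-u≢side-w
          (trans (Conn-side c₂) (trans (sym sx≡sy) (Conn-side c₁))))

  ∈-onSide⁺ : ∀ {σ x} → side x ≡ σ → x ∈ onSide σ
  ∈-onSide⁺ {σ} {x} sx≡σ = lookup⇒∈ (trans (lookup-onSide σ x) (dec-true (side x Bool.≟ σ) sx≡σ))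

  ∈-onSide⁻ : ∀ {σ x} → x ∈ onSide σ → side x ≡ σ
  ∈-onSide⁻ {σ} {x} x∈ with side x Bool.≟ σ | lookup-onSide σ x
  ... | yes sx≡σ | _      = sx≡σ
  ... | no _     | ≡false = ⊥-elim (lookup⇒∉ ≡false x∈)

  ∈-φ⁻¹∩onSide⁺ : ∀ {X σ x} → φ x ∈ X → side x ≡ σ → x ∈ φ⁻¹[ X ] ∩ onSide σ
  ∈-φ⁻¹∩onSide⁺ φx∈X sx≡σ = Sub.x∈p∩q⁺ (∈-preimage⁺ φx∈X , ∈-onSide⁺ sx≡σ)

  ∈-φ⁻¹∩onSide⁻ : ∀ {X σ x} → x ∈ φ⁻¹[ X ] ∩ onSide σ → φ x ∈ X × side x ≡ σ
  ∈-φ⁻¹∩onSide⁻ {X} {σ} x∈ = let x∈X , x∈σ = Sub.x∈p∩q⁻ φ⁻¹[ X ] (onSide σ) x∈ in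
    ∈-φ⁻¹⁻ x∈X , ∈-onSide⁻ x∈σ

  Connected-φ⁻¹-avoiding : ∀ {X} → Connected G₁ X → φ u ∉ X → Connected G₂ φ⁻¹[ X ]
  Connected-φ⁻¹-avoiding ((r , r∈X) , conn) φu∉X =
    (ψ r , ∈-φ⁻¹⁺ (φ∘ψ r) r∈X) ,
    λ x y x∈ y∈ → Conn-lift-avoiding φu∉X (conn (φ x) (φ y) (∈-φ⁻¹⁻ x∈) (∈-φ⁻¹⁻ y∈))

  Connected-φ⁻¹∩onSide : ∀ {X σ} → Connected G₁ X → Nonempty (φ⁻¹[ X ] ∩ onSide σ) →
                         Connected G₂ (φ⁻¹[ X ] ∩ onSide σ)
  Connected-φ⁻¹∩onSide {X} {σ} (_ , conn) nonempty = nonempty , λ x y x∈ y∈ →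
    let φx∈X , sx≡σ = ∈-φ⁻¹∩onSide⁻ {X} x∈
        φy∈X , sy≡σ = ∈-φ⁻¹∩onSide⁻ {X} y∈
    in W₂.Conn-restrict (onSide σ) (onSide-closed σ) (∈-onSide⁺ sx≡σ)
         (Conn-lift-same-side (trans sx≡σ (sym sy≡σ)) (conn (φ x) (φ y) φx∈X φy∈X))

  Closed-φ⁻¹ : ∀ {X} → W₁.Closed X → W₂.Closed φ⁻¹[ X ]
  Closed-φ⁻¹ {X} closed e = begin
    lookup φ⁻¹[ X ] (src G₂ e)  ≡⟨ lookup-φ⁻¹ X (src G₂ e) ⟩
    lookup X (φ (src G₂ e))     ≡⟨ cong (lookup X) (src-φ e) ⟨
    lookup X (src G₁ e)         ≡⟨ closed e ⟩
    lookup X (tgt G₁ e)         ≡⟨ cong (lookup X) (tgt-φ e) ⟩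
    lookup X (φ (tgt G₂ e))     ≡⟨ lookup-φ⁻¹ X (tgt G₂ e) ⟨
    lookup φ⁻¹[ X ] (tgt G₂ e)  ∎
    where open ≡-Reasoning

  ∈-src-φ : ∀ {X e} → src G₁ e ∈ X → φ (src G₂ e) ∈ X
  ∈-src-φ {X} {e} = subst (_∈ X) (src-φ e)

  ∈-tgt-φ : ∀ {X e} → tgt G₁ e ∈ X → φ (tgt G₂ e) ∈ X
  ∈-tgt-φ {X} {e} = subst (_∈ X) (tgt-φ e)

  Joins-φ⁻¹ : ∀ {X X′} → Joins G₁ X X′ → Joins G₂ φ⁻¹[ X ] φ⁻¹[ X′ ]
  Joins-φ⁻¹ (e , inj₁ (s∈ , t∈)) = e , inj₁ (∈-preimage⁺ (∈-src-φ s∈) , ∈-preimage⁺ (∈-tgt-φ t∈))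
  Joins-φ⁻¹ (e , inj₂ (s∈ , t∈)) = e , inj₂ (∈-preimage⁺ (∈-src-φ s∈) , ∈-preimage⁺ (∈-tgt-φ t∈))

  disjoint-φ⁻¹ : ∀ {X X′} → X ∩ X′ ≡ ∅ → φ⁻¹[ X ] ∩ φ⁻¹[ X′ ] ≡ ∅
  disjoint-φ⁻¹ X∩X′≡∅ = disjoint⁺ λ x∈ x∈′ → disjoint⁻ X∩X′≡∅ (∈-φ⁻¹⁻ x∈) (∈-φ⁻¹⁻ x∈′)

  -- a G₁-tripartition whose second and third parts avoid φ u: those parts lie on one side σ
  -- of G₂, and the first part is cut down to that side
  module SplitTripartition {X₁ X₂ X₃} (T : Tripartition G₁ X₁ X₂ X₃)
                           (φu∉X₂ : φ u ∉ X₂) (φu∉X₃ : φ u ∉ X₃) where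
    open Tripartition T

    same-side : ∀ {X} → Connected G₁ X → φ u ∉ X → ∀ {x y} → φ x ∈ X → φ y ∈ X → side x ≡ side y
    same-side (_ , conn) φu∉X φx∈X φy∈X = Conn-side (Conn-lift-avoiding φu∉X (conn _ _ φx∈X φy∈X))

    r₂ : Fin q
    r₂ = ψ (proj₁ nonempty₂)

    φr₂∈X₂ : φ r₂ ∈ X₂
    φr₂∈X₂ = subst (_∈ X₂) (sym (φ∘ψ _)) (proj₂ nonempty₂)

    σ : Bool
    σ = side r₂

    side₂ : ∀ {x} → φ x ∈ X₂ → side x ≡ σ
    side₂ φx∈X₂ = same-side conn₂ φu∉X₂ φx∈X₂ φr₂∈X₂

    side₃ : ∀ {x} → φ x ∈ X₃ → side x ≡ σ
    side₃ = via join₂₃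
      where
      via : Joins G₁ X₂ X₃ → ∀ {x} → φ x ∈ X₃ → side x ≡ σ
      via (e , inj₁ (s∈X₂ , t∈X₃)) φx∈X₃ = trans (same-side conn₃ φu∉X₃ φx∈X₃ (∈-tgt-φ t∈X₃))
        (trans (sym (side-edge e)) (side₂ (∈-src-φ s∈X₂)))
      via (e , inj₂ (s∈X₃ , t∈X₂)) φx∈X₃ = trans (same-side conn₃ φu∉X₃ φx∈X₃ (∈-src-φ s∈X₃))
        (trans (side-edge e) (side₂ (∈-tgt-φ t∈X₂)))

    Y₁ D : Subset q
    Y₁ = φ⁻¹[ X₁ ] ∩ onSide σ
    D  = φ⁻¹[ comp ] ∩ onSide σ

    φ⁻¹comp-closed : W₂.Closed φ⁻¹[ comp ]
    φ⁻¹comp-closed = Closed-φ⁻¹ {comp} (W₁.δ≡∅⇒Closed {comp} (proj₂ isComp))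

    isComponent : Component G₂ D
    isComponent =
      Connected-φ⁻¹∩onSide (proj₁ isComp) (r₂ , ∈-φ⁻¹∩onSide⁺ (W₁.∈-comp₂ T φr₂∈X₂) refl) ,
      W₂.Closed⇒δ≡∅ {D} (W₂.Closed-∩ {φ⁻¹[ comp ]} {onSide σ} φ⁻¹comp-closed (onSide-closed σ))

    cover₂ : (Y₁ ∪ φ⁻¹[ X₂ ]) ∪ φ⁻¹[ X₃ ] ≡ D
    cover₂ = Sub.⊆-antisym parts⊆D D⊆parts
      where
      parts⊆D : (Y₁ ∪ φ⁻¹[ X₂ ]) ∪ φ⁻¹[ X₃ ] ⊆ D
      parts⊆D x∈ with ∈-∪⁻ Y₁ φ⁻¹[ X₂ ] φ⁻¹[ X₃ ] x∈
      ... | inj₁ x∈Y₁ = let φx∈X₁ , sx≡σ = ∈-φ⁻¹∩onSide⁻ {X₁} x∈Y₁ in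
                        ∈-φ⁻¹∩onSide⁺ (W₁.∈-comp₁ T φx∈X₁) sx≡σ
      ... | inj₂ (inj₁ x∈) = ∈-φ⁻¹∩onSide⁺ (W₁.∈-comp₂ T (∈-φ⁻¹⁻ x∈)) (side₂ (∈-φ⁻¹⁻ x∈))
      ... | inj₂ (inj₂ x∈) = ∈-φ⁻¹∩onSide⁺ (W₁.∈-comp₃ T (∈-φ⁻¹⁻ x∈)) (side₃ (∈-φ⁻¹⁻ x∈))
      D⊆parts : D ⊆ (Y₁ ∪ φ⁻¹[ X₂ ]) ∪ φ⁻¹[ X₃ ]
      D⊆parts x∈ with ∈-φ⁻¹∩onSide⁻ {comp} x∈
      ... | φx∈C , sx≡σ with W₁.∈-comp⁻ T φx∈C
      ...   | inj₁ φx∈X₁          = ∈-∪₁ (∈-φ⁻¹∩onSide⁺ φx∈X₁ sx≡σ)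
      ...   | inj₂ (inj₁ φx∈X₂) = ∈-∪₂ (∈-preimage⁺ φx∈X₂)
      ...   | inj₂ (inj₂ φx∈X₃) = ∈-∪₃ (∈-preimage⁺ φx∈X₃)

    Y₁⊆φ⁻¹X₁ : Y₁ ⊆ φ⁻¹[ X₁ ]
    Y₁⊆φ⁻¹X₁ = Sub.p∩q⊆p φ⁻¹[ X₁ ] (onSide σ)

    Joins-Y₁ : ∀ {X} → (∀ {x} → φ x ∈ X → side x ≡ σ) → Joins G₁ X₁ X → Joins G₂ Y₁ φ⁻¹[ X ]
    Joins-Y₁ sideX (e , inj₁ (s∈X₁ , t∈X)) = e , inj₁
      ( ∈-φ⁻¹∩onSide⁺ (∈-src-φ s∈X₁) (trans (side-edge e) (sideX (∈-tgt-φ t∈X)))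
      , ∈-preimage⁺ (∈-tgt-φ t∈X))
    Joins-Y₁ sideX (e , inj₂ (s∈X , t∈X₁)) = e , inj₂
      ( ∈-preimage⁺ (∈-src-φ s∈X)
      , ∈-φ⁻¹∩onSide⁺ (∈-tgt-φ t∈X₁) (trans (sym (side-edge e)) (sideX (∈-src-φ s∈X))))

    conn-Y₁ : Connected G₂ Y₁
    conn-Y₁ = Connected-φ⁻¹∩onSide conn₁ (W₂.Joins-nonemptyˡ (Joins-Y₁ side₂ join₁₂))

    conn-Y₂ : Connected G₂ φ⁻¹[ X₂ ]
    conn-Y₂ = Connected-φ⁻¹-avoiding conn₂ φu∉X₂

    conn-Y₃ : Connected G₂ φ⁻¹[ X₃ ]
    conn-Y₃ = Connected-φ⁻¹-avoiding conn₃ φu∉X₃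

    tripartition : Tripartition G₂ Y₁ φ⁻¹[ X₂ ] φ⁻¹[ X₃ ]
    tripartition = record
      { comp = D ; isComp = isComponent ; cover = cover₂
      ; disj₁₂ = disjoint-⊆ˡ Y₁⊆φ⁻¹X₁ (disjoint-φ⁻¹ disj₁₂)
      ; disj₁₃ = disjoint-⊆ˡ Y₁⊆φ⁻¹X₁ (disjoint-φ⁻¹ disj₁₃)
      ; disj₂₃ = disjoint-φ⁻¹ disj₂₃
      ; nonempty₁ = proj₁ conn-Y₁ ; nonempty₂ = proj₁ conn-Y₂ ; nonempty₃ = proj₁ conn-Y₃
      ; conn₁ = conn-Y₁ ; conn₂ = conn-Y₂ ; conn₃ = conn-Y₃
      ; join₁₂ = Joins-Y₁ side₂ join₁₂ ; join₁₃ = Joins-Y₁ side₃ join₁₃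
      ; join₂₃ = Joins-φ⁻¹ join₂₃ }

    -- comp is closed and X₂, X₃ lie on side σ, so an edge from X₁ off side σ stays in X₁
    X₁-off-σ : ∀ {e x z} → W₂.Links e x z → side z ≢ σ → x ∈ φ⁻¹[ X₁ ] → z ∈ φ⁻¹[ X₁ ]
    X₁-off-σ ℓ sz≢σ x∈ with W₁.∈-comp⁻ T (∈-φ⁻¹⁻ (W₂.Closed-Links φ⁻¹comp-closed ℓ
                                           (∈-preimage⁺ (W₁.∈-comp₁ T (∈-φ⁻¹⁻ x∈)))))
    ... | inj₁ φz∈X₁          = ∈-preimage⁺ φz∈X₁
    ... | inj₂ (inj₁ φz∈X₂) = ⊥-elim (sz≢σ (side₂ φz∈X₂))
    ... | inj₂ (inj₂ φz∈X₃) = ⊥-elim (sz≢σ (side₃ φz∈X₃))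

    δ-Y₁ : δ G₂ Y₁ ≡ δ G₁ X₁
    δ-Y₁ = trans (W₂.δ-edgewise {Y₁} {φ⁻¹[ X₁ ]} edge-case) (sym (δ-φ⁻¹ X₁))
      where
      on-σ : ∀ {x} → side x ≡ σ → lookup Y₁ x ≡ lookup φ⁻¹[ X₁ ] x
      on-σ sx≡σ = lookup-≡ Y₁⊆φ⁻¹X₁ (λ x∈ → Sub.x∈p∩q⁺ (x∈ , ∈-onSide⁺ sx≡σ))
      off-σ : ∀ {x} → side x ≢ σ → lookup Y₁ x ≡ false
      off-σ sx≢σ = ∉⇒lookup (λ x∈ → sx≢σ (proj₂ (∈-φ⁻¹∩onSide⁻ {X₁} x∈)))
      edge-case : ∀ e → W₂.AgreeOnEnds Y₁ φ⁻¹[ X₁ ] e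
                      ⊎ (W₂.Unseparated Y₁ e × W₂.Unseparated φ⁻¹[ X₁ ] e)
      edge-case e with side (src G₂ e) Bool.≟ σ
      ... | yes s≡σ = inj₁ (on-σ s≡σ , on-σ (trans (sym (side-edge e)) s≡σ))
      ... | no s≢σ  = inj₂ ( trans (off-σ s≢σ) (sym (off-σ t≢σ))
                           , lookup-≡ (X₁-off-σ (inj₁ (refl , refl)) t≢σ) (X₁-off-σ (inj₂ (refl , refl)) s≢σ))
        where
        t≢σ : side (tgt G₂ e) ≢ σ
        t≢σ t≡σ = s≢σ (trans (side-edge e) t≡σ)

    result : HasTripartition G₂ (δ G₁ X₁) (δ G₁ X₂) (δ G₁ X₃)
    result = Y₁ , φ⁻¹[ X₂ ] , φ⁻¹[ X₃ ] , tripartition , δ-Y₁ , sym (δ-φ⁻¹ X₂) , sym (δ-φ⁻¹ X₃)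

  tripartition₁⇒₂ : TripartitionsRealizedIn G₁ G₂
  tripartition₁⇒₂ {X₁} {X₂} {X₃} T with φ u Sub.∈? X₂ | φ u Sub.∈? X₃
  ... | yes φu∈X₂ | _ = W₂.HasTripartition-swap₁₂ (SplitTripartition.result (W₁.Tripartition-swap₁₂ T)
          (disjoint⁻ʳ (Tripartition.disj₁₂ T) φu∈X₂) (disjoint⁻ (Tripartition.disj₂₃ T) φu∈X₂))
  ... | no φu∉X₂ | yes φu∈X₃ = W₂.HasTripartition-rotate (SplitTripartition.result
          (W₁.Tripartition-swap₁₂ (W₁.Tripartition-swap₂₃ T)) (disjoint⁻ʳ (Tripartition.disj₁₃ T) φu∈X₃) φu∉X₂)
  ... | no φu∉X₂ | no φu∉X₃ = SplitTripartition.result T φu∉X₂ φu∉X₃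

  saturated-∋ : ∀ {Z} → u ∈ Z → w ∈ Z → Saturated Z
  saturated-∋ u∈Z w∈Z = trans (∈⇒lookup u∈Z) (sym (∈⇒lookup w∈Z))

  saturated-∌ : ∀ {Z} → u ∉ Z → w ∉ Z → Saturated Z
  saturated-∌ u∉Z w∉Z = trans (∉⇒lookup u∉Z) (sym (∉⇒lookup w∉Z))

  φ[]-∪ : ∀ A B → φ[ A ∪ B ] ≡ φ[ A ] ∪ φ[ B ]
  φ[]-∪ A B = lookup-ext λ v → begin
    lookup φ[ A ∪ B ] v                   ≡⟨ lookup-φ[] (A ∪ B) v ⟩
    lookup (A ∪ B) (ψ v)                  ≡⟨ lookup-∪ A B (ψ v) ⟩
    lookup A (ψ v) ∨ lookup B (ψ v)       ≡⟨ cong₂ _∨_ (lookup-φ[] A v) (lookup-φ[] B v) ⟨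
    lookup φ[ A ] v ∨ lookup φ[ B ] v     ≡⟨ lookup-∪ φ[ A ] φ[ B ] v ⟨
    lookup (φ[ A ] ∪ φ[ B ]) v            ∎
    where open ≡-Reasoning

  Joins-φ[] : ∀ {A B} → Saturated A → Saturated B → Joins G₂ A B → Joins G₁ φ[ A ] φ[ B ]
  Joins-φ[] {A} {B} satA satB (e , inj₁ (s∈A , t∈B)) =
    e , inj₁ (subst (_∈ φ[ A ]) (sym (src-φ e)) (∈-φ[]⁺ {A} satA s∈A) ,
              subst (_∈ φ[ B ]) (sym (tgt-φ e)) (∈-φ[]⁺ {B} satB t∈B))
  Joins-φ[] {A} {B} satA satB (e , inj₂ (s∈B , t∈A)) =
    e , inj₂ (subst (_∈ φ[ B ]) (sym (src-φ e)) (∈-φ[]⁺ {B} satB s∈B) ,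
              subst (_∈ φ[ A ]) (sym (tgt-φ e)) (∈-φ[]⁺ {A} satA t∈A))

  ImageConnected : Subset q → Set
  ImageConnected Z = ∀ x y → x ∈ Z → y ∈ Z → Conn G₁ φ[ Z ] ∅ (φ x) (φ y)

  Connected-φ[] : ∀ {Z} → Saturated Z → Nonempty Z → ImageConnected Z → Connected G₁ φ[ Z ]
  Connected-φ[] {Z} sat (z , z∈Z) conn = (φ z , ∈-φ[]⁺ {Z} sat z∈Z) , λ x y x∈ y∈ →
    subst₂ (Conn G₁ φ[ Z ] ∅) (φ∘ψ x) (φ∘ψ y) (conn (ψ x) (ψ y) (∈-φ[]⁻ x∈) (∈-φ[]⁻ y∈))

  ImageConnected-⊆ : ∀ {Z Z′} → Saturated Z′ → Z ⊆ Z′ → Connected G₂ Z →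
                     ∀ {x y} → x ∈ Z → y ∈ Z → Conn G₁ φ[ Z′ ] ∅ (φ x) (φ y)
  ImageConnected-⊆ {Z′ = Z′} sat Z⊆Z′ (_ , conn) x∈ y∈ =
    Conn-φ (λ z∈ → ∈-φ[]⁺ {Z′} sat (Z⊆Z′ z∈)) (conn _ _ x∈ y∈)

  ImageConnected-connected : ∀ {Z} → Saturated Z → Connected G₂ Z → ImageConnected Z
  ImageConnected-connected sat cZ _ _ = ImageConnected-⊆ sat (λ z∈ → z∈) cZ

  ImageConnected-∪ : ∀ {A B} → Saturated (A ∪ B) → Connected G₂ A → Connected G₂ B →
                     u ∈ A → w ∈ B → ImageConnected (A ∪ B)
  ImageConnected-∪ {A} {B} sat cA cB u∈A w∈B = connect
    where
    inA : ∀ {x y} → x ∈ A → y ∈ A → Conn G₁ φ[ A ∪ B ] ∅ (φ x) (φ y)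
    inA = ImageConnected-⊆ sat (Sub.p⊆p∪q B) cA
    inB : ∀ {x y} → x ∈ B → y ∈ B → Conn G₁ φ[ A ∪ B ] ∅ (φ x) (φ y)
    inB = ImageConnected-⊆ sat (Sub.q⊆p∪q A B) cB
    connect : ImageConnected (A ∪ B)
    connect x y x∈ y∈ with Sub.x∈p∪q⁻ A B x∈ | Sub.x∈p∪q⁻ A B y∈
    ... | inj₁ x∈A | inj₁ y∈A = inA x∈A y∈A
    ... | inj₂ x∈B | inj₂ y∈B = inB x∈B y∈B
    ... | inj₁ x∈A | inj₂ y∈B =
      W₁.Conn-trans (inA x∈A u∈A) (subst (λ v → Conn G₁ φ[ A ∪ B ] ∅ v (φ y)) (sym φu≡φw) (inB w∈B y∈B))
    ... | inj₂ x∈B | inj₁ y∈A =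
      W₁.Conn-trans (inB x∈B w∈B) (subst (λ v → Conn G₁ φ[ A ∪ B ] ∅ v (φ y)) φu≡φw (inA u∈A y∈A))

  record ImageTripartition (Z₁ Z₂ Z₃ : Subset q) : Set where
    field
      comp       : Subset q
      cover      : (Z₁ ∪ Z₂) ∪ Z₃ ≡ comp
      closed     : W₂.Closed comp
      saturated  : Saturated comp
      connected  : ImageConnected comp
      saturated₁ : Saturated Z₁
      saturated₂ : Saturated Z₂
      saturated₃ : Saturated Z₃
      disj₁₂     : Z₁ ∩ Z₂ ≡ ∅
      disj₁₃     : Z₁ ∩ Z₃ ≡ ∅
      disj₂₃     : Z₂ ∩ Z₃ ≡ ∅
      nonempty₁  : Nonempty Z₁
      nonempty₂  : Nonempty Z₂
      nonempty₃  : Nonempty Z₃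
      connected₁ : ImageConnected Z₁
      connected₂ : ImageConnected Z₂
      connected₃ : ImageConnected Z₃
      join₁₂     : Joins G₂ Z₁ Z₂
      join₁₃     : Joins G₂ Z₁ Z₃
      join₂₃     : Joins G₂ Z₂ Z₃

  disjoint-φ[] : ∀ {A B} → A ∩ B ≡ ∅ → φ[ A ] ∩ φ[ B ] ≡ ∅
  disjoint-φ[] A∩B≡∅ = disjoint⁺ λ v∈ v∈′ → disjoint⁻ A∩B≡∅ (∈-φ[]⁻ v∈) (∈-φ[]⁻ v∈′)

  ImageTripartition⇒Tripartition : ∀ {Z₁ Z₂ Z₃} → ImageTripartition Z₁ Z₂ Z₃ →
    HasTripartition G₁ (δ G₂ Z₁) (δ G₂ Z₂) (δ G₂ Z₃)
  ImageTripartition⇒Tripartition {Z₁} {Z₂} {Z₃} I = φ[ Z₁ ] , φ[ Z₂ ] , φ[ Z₃ ] , record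
    { comp = φ[ comp ]
    ; isComp = Connected-φ[] {comp} saturated nonempty connected ,
               trans (δ-φ[] {comp} saturated) (W₂.Closed⇒δ≡∅ {comp} closed)
    ; cover = begin
        (φ[ Z₁ ] ∪ φ[ Z₂ ]) ∪ φ[ Z₃ ] ≡⟨ cong (_∪ φ[ Z₃ ]) (φ[]-∪ Z₁ Z₂) ⟨
        φ[ Z₁ ∪ Z₂ ] ∪ φ[ Z₃ ]        ≡⟨ φ[]-∪ (Z₁ ∪ Z₂) Z₃ ⟨
        φ[ (Z₁ ∪ Z₂) ∪ Z₃ ]           ≡⟨ cong φ[_] cover ⟩
        φ[ comp ]                     ∎
    ; disj₁₂ = disjoint-φ[] disj₁₂ ; disj₁₃ = disjoint-φ[] disj₁₃ ; disj₂₃ = disjoint-φ[] disj₂₃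
    ; nonempty₁ = proj₁ conn₁ ; nonempty₂ = proj₁ conn₂ ; nonempty₃ = proj₁ conn₃
    ; conn₁ = conn₁ ; conn₂ = conn₂ ; conn₃ = conn₃
    ; join₁₂ = Joins-φ[] {Z₁} {Z₂} saturated₁ saturated₂ join₁₂
    ; join₁₃ = Joins-φ[] {Z₁} {Z₃} saturated₁ saturated₃ join₁₃
    ; join₂₃ = Joins-φ[] {Z₂} {Z₃} saturated₂ saturated₃ join₂₃ }
    , δ-φ[] {Z₁} saturated₁ , δ-φ[] {Z₂} saturated₂ , δ-φ[] {Z₃} saturated₃
    where
    open ImageTripartition I
    open ≡-Reasoning
    nonempty : Nonempty comp
    nonempty = proj₁ nonempty₁ , subst (_ ∈_) cover (∈-∪₁ (proj₂ nonempty₁))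
    conn₁ : Connected G₁ φ[ Z₁ ]
    conn₁ = Connected-φ[] {Z₁} saturated₁ nonempty₁ connected₁
    conn₂ : Connected G₁ φ[ Z₂ ]
    conn₂ = Connected-φ[] {Z₂} saturated₂ nonempty₂ connected₂
    conn₃ : Connected G₁ φ[ Z₃ ]
    conn₃ = Connected-φ[] {Z₃} saturated₃ nonempty₃ connected₃

  ImageTripartition-avoiding : ∀ {Y₁ Y₂ Y₃} (T : Tripartition G₂ Y₁ Y₂ Y₃) →
    u ∉ Tripartition.comp T → w ∉ Tripartition.comp T → ImageTripartition Y₁ Y₂ Y₃
  ImageTripartition-avoiding {Y₁} {Y₂} {Y₃} T u∉D w∉D = record
    { comp = comp ; cover = cover ; closed = W₂.δ≡∅⇒Closed {comp} (proj₂ isComp)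
    ; saturated = saturated-∌ u∉D w∉D
    ; connected = ImageConnected-connected (saturated-∌ u∉D w∉D) (proj₁ isComp)
    ; saturated₁ = sat₁ ; saturated₂ = sat₂ ; saturated₃ = sat₃
    ; disj₁₂ = disj₁₂ ; disj₁₃ = disj₁₃ ; disj₂₃ = disj₂₃
    ; nonempty₁ = nonempty₁ ; nonempty₂ = nonempty₂ ; nonempty₃ = nonempty₃
    ; connected₁ = ImageConnected-connected sat₁ conn₁
    ; connected₂ = ImageConnected-connected sat₂ conn₂
    ; connected₃ = ImageConnected-connected sat₃ conn₃
    ; join₁₂ = join₁₂ ; join₁₃ = join₁₃ ; join₂₃ = join₂₃ }
    where
    open Tripartition T
    sat₁ : Saturated Y₁
    sat₁ = saturated-∌ (u∉D ∘ W₂.∈-comp₁ T) (w∉D ∘ W₂.∈-comp₁ T)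
    sat₂ : Saturated Y₂
    sat₂ = saturated-∌ (u∉D ∘ W₂.∈-comp₂ T) (w∉D ∘ W₂.∈-comp₂ T)
    sat₃ : Saturated Y₃
    sat₃ = saturated-∌ (u∉D ∘ W₂.∈-comp₃ T) (w∉D ∘ W₂.∈-comp₃ T)

  -- a G₂-tripartition with u in its first part: the component W of w is added to that part
  module GlueTripartition {Y₁ Y₂ Y₃} (T : Tripartition G₂ Y₁ Y₂ Y₃) (u∈Y₁ : u ∈ Y₁) where
    open Tripartition T
    open W₂.ComponentOf w
      renaming (vertices to W; isComponent to W-isComponent; t∈vertices to w∈W; closed to W-closed)

    D-closed : W₂.Closed comp
    D-closed = W₂.δ≡∅⇒Closed {comp} (proj₂ isComp)

    u∈D : u ∈ comp
    u∈D = W₂.∈-comp₁ T u∈Y₁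

    w∉D : w ∉ comp
    w∉D w∈D = side-u≢side-w (Conn-side (proj₂ (proj₁ isComp) u w u∈D w∈D))

    W∩D : ∀ {y} → y ∈ W → y ∉ comp
    W∩D y∈W y∈D = w∉D (W₂.Closed-Conn D-closed y∈D (W₂.Conn-sym (∈⇒Conn y∈W)))

    Z₁ E : Subset q
    Z₁ = Y₁ ∪ W
    E  = comp ∪ W

    cover-E : (Z₁ ∪ Y₂) ∪ Y₃ ≡ E
    cover-E = Sub.⊆-antisym parts⊆E E⊆parts
      where
      parts⊆E : (Z₁ ∪ Y₂) ∪ Y₃ ⊆ E
      parts⊆E x∈ with ∈-∪⁻ Z₁ Y₂ Y₃ x∈
      ... | inj₁ x∈Z₁ with Sub.x∈p∪q⁻ Y₁ W x∈Z₁
      ...   | inj₁ x∈Y₁ = Sub.p⊆p∪q W (W₂.∈-comp₁ T x∈Y₁)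
      ...   | inj₂ x∈W  = Sub.q⊆p∪q comp W x∈W
      parts⊆E x∈ | inj₂ (inj₁ x∈Y₂) = Sub.p⊆p∪q W (W₂.∈-comp₂ T x∈Y₂)
      parts⊆E x∈ | inj₂ (inj₂ x∈Y₃) = Sub.p⊆p∪q W (W₂.∈-comp₃ T x∈Y₃)
      E⊆parts : E ⊆ (Z₁ ∪ Y₂) ∪ Y₃
      E⊆parts x∈ with Sub.x∈p∪q⁻ comp W x∈
      ... | inj₂ x∈W = ∈-∪₁ (Sub.q⊆p∪q Y₁ W x∈W)
      ... | inj₁ x∈D with W₂.∈-comp⁻ T x∈D
      ...   | inj₁ x∈Y₁          = ∈-∪₁ (Sub.p⊆p∪q W x∈Y₁)
      ...   | inj₂ (inj₁ x∈Y₂) = ∈-∪₂ x∈Y₂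
      ...   | inj₂ (inj₂ x∈Y₃) = ∈-∪₃ x∈Y₃

    disjoint-Z₁ : ∀ {Y} → Y₁ ∩ Y ≡ ∅ → Y ⊆ comp → Z₁ ∩ Y ≡ ∅
    disjoint-Z₁ {Y} Y₁∩Y≡∅ Y⊆D = disjoint⁺ λ x∈Z₁ x∈Y → case-Z₁ (Sub.x∈p∪q⁻ Y₁ W x∈Z₁) x∈Y
      where
      case-Z₁ : ∀ {x} → x ∈ Y₁ ⊎ x ∈ W → x ∉ Y
      case-Z₁ (inj₁ x∈Y₁) = disjoint⁻ Y₁∩Y≡∅ x∈Y₁
      case-Z₁ (inj₂ x∈W)  = W∩D x∈W ∘ Y⊆D

    sat₂ : Saturated Y₂
    sat₂ = saturated-∌ (disjoint⁻ disj₁₂ u∈Y₁) (w∉D ∘ W₂.∈-comp₂ T)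

    sat₃ : Saturated Y₃
    sat₃ = saturated-∌ (disjoint⁻ disj₁₃ u∈Y₁) (w∉D ∘ W₂.∈-comp₃ T)

    sat-Z₁ : Saturated Z₁
    sat-Z₁ = saturated-∋ (Sub.p⊆p∪q W u∈Y₁) (Sub.q⊆p∪q Y₁ W w∈W)

    sat-E : Saturated E
    sat-E = saturated-∋ (Sub.p⊆p∪q W u∈D) (Sub.q⊆p∪q comp W w∈W)

    Joins-Z₁ : ∀ {Y} → Joins G₂ Y₁ Y → Joins G₂ Z₁ Y
    Joins-Z₁ (e , inj₁ (s∈ , t∈)) = e , inj₁ (Sub.p⊆p∪q W s∈ , t∈)
    Joins-Z₁ (e , inj₂ (s∈ , t∈)) = e , inj₂ (s∈ , Sub.p⊆p∪q W t∈)

    imageTripartition : ImageTripartition Z₁ Y₂ Y₃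
    imageTripartition = record
      { comp = E ; cover = cover-E
      ; closed = W₂.Closed-∪ {comp} {W} D-closed W-closed
      ; saturated = sat-E
      ; connected = ImageConnected-∪ sat-E (proj₁ isComp) (proj₁ W-isComponent) u∈D w∈W
      ; saturated₁ = sat-Z₁ ; saturated₂ = sat₂ ; saturated₃ = sat₃
      ; disj₁₂ = disjoint-Z₁ disj₁₂ (W₂.∈-comp₂ T) ; disj₁₃ = disjoint-Z₁ disj₁₃ (W₂.∈-comp₃ T)
      ; disj₂₃ = disj₂₃
      ; nonempty₁ = u , Sub.p⊆p∪q W u∈Y₁ ; nonempty₂ = nonempty₂ ; nonempty₃ = nonempty₃
      ; connected₁ = ImageConnected-∪ sat-Z₁ conn₁ (proj₁ W-isComponent) u∈Y₁ w∈W
      ; connected₂ = ImageConnected-connected sat₂ conn₂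
      ; connected₃ = ImageConnected-connected sat₃ conn₃
      ; join₁₂ = Joins-Z₁ join₁₂ ; join₁₃ = Joins-Z₁ join₁₃ ; join₂₃ = join₂₃ }

    -- W is a whole component disjoint from comp, so adding it to Y₁ changes no cut edge
    δ-Z₁ : δ G₂ Z₁ ≡ δ G₂ Y₁
    δ-Z₁ = W₂.δ-edgewise {Z₁} {Y₁} edge-case
      where
      W∌Y₁ : ∀ {x} → x ∈ W → x ∉ Y₁
      W∌Y₁ x∈W = W∩D x∈W ∘ W₂.∈-comp₁ T
      outside-W : ∀ {x} → x ∉ W → lookup Z₁ x ≡ lookup Y₁ x
      outside-W x∉W = lookup-≡ (λ x∈ → [ (λ x∈Y₁ → x∈Y₁) , (⊥-elim ∘ x∉W) ]′ (Sub.x∈p∪q⁻ Y₁ W x∈))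
                               (Sub.p⊆p∪q W)
      edge-case : ∀ e → W₂.AgreeOnEnds Z₁ Y₁ e ⊎ (W₂.Unseparated Z₁ e × W₂.Unseparated Y₁ e)
      edge-case e with src G₂ e Sub.∈? W
      ... | yes s∈W = inj₂ ( lookup-≡ (λ _ → Sub.q⊆p∪q Y₁ W t∈W) (λ _ → Sub.q⊆p∪q Y₁ W s∈W)
                           , lookup-≡ (⊥-elim ∘ W∌Y₁ s∈W) (⊥-elim ∘ W∌Y₁ t∈W))
        where
        t∈W : tgt G₂ e ∈ W
        t∈W = W₂.Closed-Links W-closed (inj₁ (refl , refl)) s∈W
      ... | no s∉W = inj₁ (outside-W s∉W , outside-W (s∉W ∘ W₂.Closed-Links W-closed (inj₂ (refl , refl))))

    result : HasTripartition G₁ (δ G₂ Y₁) (δ G₂ Y₂) (δ G₂ Y₃)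
    result with ImageTripartition⇒Tripartition imageTripartition
    ... | X₁ , X₂ , X₃ , T₁ , δ₁ , δ₂ , δ₃ = X₁ , X₂ , X₃ , T₁ , trans δ₁ δ-Z₁ , δ₂ , δ₃

  ConnModulo-Full : ∀ {S F x y} → ConnModulo S F x y → ConnModulo Full F x y
  ConnModulo-Full (inj₁ c)               = inj₁ (W₂.Conn-Full c)
  ConnModulo-Full (inj₂ (inj₁ (c , c′))) = inj₂ (inj₁ (W₂.Conn-Full c , W₂.Conn-Full c′))
  ConnModulo-Full (inj₂ (inj₂ (c , c′))) = inj₂ (inj₂ (W₂.Conn-Full c , W₂.Conn-Full c′))

  Conn-φ-Full : ∀ {F x y} → Conn G₂ Full F x y → Conn G₁ Full F (φ x) (φ y)
  Conn-φ-Full = Conn-φ (λ _ → Sub.∈⊤)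

  -- the component of φ u splits into the part on u's side (label zero) and the rest
  module SplitComponents {F k} (H : HasComponents G₁ F k) where
    c₁ : Fin p → Fin k
    c₁ = proj₁ H

    c₁-Conn : ∀ {v v′} → c₁ v ≡ c₁ v′ ⇔ Conn G₁ Full F v v′
    c₁-Conn = proj₂ (proj₂ H) _ _

    relabel : Bool → Fin k → Fin (suc k)
    relabel σ i = if σ ∧ does (i ≟ᶠ c₁ (φ u)) then zero else suc i

    relabel-cases : ∀ σ i → (σ ≡ true × i ≡ c₁ (φ u) × relabel σ i ≡ zero)
                          ⊎ (¬ (σ ≡ true × i ≡ c₁ (φ u)) × relabel σ i ≡ suc i)
    relabel-cases true i with i ≟ᶠ c₁ (φ u)
    ... | yes i≡ = inj₁ (refl , i≡ , refl)
    ... | no i≢  = inj₂ ((λ (_ , i≡) → i≢ i≡) , refl)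
    relabel-cases false i = inj₂ ((λ ()) , refl)

    c₂ : Fin q → Fin (suc k)
    c₂ x = relabel (side x) (c₁ (φ x))

    Conn⇒≡ : ∀ {x y} → Conn G₂ Full F x y → c₂ x ≡ c₂ y
    Conn⇒≡ c = cong₂ relabel (Conn-side c) (Equivalence.from c₁-Conn (Conn-φ-Full c))

    zero≢suc : ∀ {i : Fin k} → zero ≢ suc i
    zero≢suc ()

    OnUSide : Fin q → Set
    OnUSide x = side x ≡ true × c₁ (φ x) ≡ c₁ (φ u)

    Conn-off-u-side : ∀ {x y} → ¬ OnUSide x → ¬ OnUSide y → c₁ (φ x) ≡ c₁ (φ y) → Conn G₂ Full F x y
    Conn-off-u-side {x} {y} x≁u y≁u c₁x≡c₁y
      with ConnModulo-Full (Conn-lift (Equivalence.to c₁-Conn c₁x≡c₁y) x y refl refl)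
    ... | inj₁ c = c
    ... | inj₂ (inj₁ (x~u , _)) =
      ⊥-elim (x≁u (trans (Conn-side x~u) side-u , Equivalence.from c₁-Conn (Conn-φ-Full x~u)))
    ... | inj₂ (inj₂ (_ , u~y)) =
      ⊥-elim (y≁u (trans (sym (Conn-side u~y)) side-u , sym (Equivalence.from c₁-Conn (Conn-φ-Full u~y))))

    ≡⇒Conn : ∀ x y → c₂ x ≡ c₂ y → Conn G₂ Full F x y
    ≡⇒Conn x y eq with relabel-cases (side x) (c₁ (φ x)) | relabel-cases (side y) (c₁ (φ y))
    ... | inj₁ (sx , cx , _) | inj₁ (sy , cy , _) =
      W₂.Conn-Full (Conn-lift-same-side (trans sx (sym sy)) (Equivalence.to c₁-Conn (trans cx (sym cy))))
    ... | inj₁ (_ , _ , x↦0) | inj₂ (_ , y↦s) = ⊥-elim (zero≢suc (trans (sym x↦0) (trans eq y↦s)))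
    ... | inj₂ (_ , x↦s) | inj₁ (_ , _ , y↦0) = ⊥-elim (zero≢suc (trans (sym y↦0) (trans (sym eq) x↦s)))
    ... | inj₂ (x≁u , x↦s) | inj₂ (y≁u , y↦s) =
      Conn-off-u-side x≁u y≁u (Fin.suc-injective (trans (sym x↦s) (trans eq y↦s)))

    surjective : ∀ i → ∃ λ x → c₂ x ≡ i
    surjective zero with relabel-cases (side u) (c₁ (φ u))
    ... | inj₁ (_ , _ , u↦0) = u , u↦0
    ... | inj₂ (u≁u , _)     = ⊥-elim (u≁u (side-u , refl))
    surjective (suc j) with proj₁ (proj₂ H) j | j ≟ᶠ c₁ (φ u)
    ... | _ | yes j≡ with relabel-cases (side w) (c₁ (φ w))
    ...   | inj₁ (sw , _ , _) = ⊥-elim (side-u≢side-w (trans side-u (sym sw)))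
    ...   | inj₂ (_ , w↦s)    = w , trans w↦s (cong suc (trans (cong c₁ (sym φu≡φw)) (sym j≡)))
    surjective (suc j) | v , v↦j | no j≢ with relabel-cases (side (ψ v)) (c₁ (φ (ψ v)))
    ...   | inj₁ (_ , cψv , _) = ⊥-elim (j≢ (trans (sym v↦j) (trans (cong c₁ (sym (φ∘ψ v))) cψv)))
    ...   | inj₂ (_ , ψv↦s)    = ψ v , trans ψv↦s (cong suc (trans (cong c₁ (φ∘ψ v)) v↦j))

    result : HasComponents G₂ F (suc k)
    result = c₂ , surjective , λ x y → mk⇔ (≡⇒Conn x y) Conn⇒≡

  HasComponents₁⇒₂ : ∀ {F k} → HasComponents G₁ F k → HasComponents G₂ F (suc k)
  HasComponents₁⇒₂ = SplitComponents.result

  -- the classes of u and w merge; punchOut then closes the gap left by w's label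
  module MergeComponents {F k} (H : HasComponents G₂ F (suc k)) where
    c₂ : Fin q → Fin (suc k)
    c₂ = proj₁ H

    c₂-Conn : ∀ {x y} → c₂ x ≡ c₂ y ⇔ Conn G₂ Full F x y
    c₂-Conn = proj₂ (proj₂ H) _ _

    a b : Fin (suc k)
    a = c₂ u
    b = c₂ w

    a≢b : a ≢ b
    a≢b a≡b = side-u≢side-w (Conn-side (Equivalence.to c₂-Conn a≡b))

    merge : Fin (suc k) → Fin (suc k)
    merge j = if does (j ≟ᶠ b) then a else j

    merge-cases : ∀ j → (j ≡ b × merge j ≡ a) ⊎ (j ≢ b × merge j ≡ j)
    merge-cases j with j ≟ᶠ b
    ... | yes j≡b = inj₁ (j≡b , refl)
    ... | no j≢b  = inj₂ (j≢b , refl)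

    b≢merge : ∀ j → b ≢ merge j
    b≢merge j with merge-cases j
    ... | inj₁ (_ , j↦a)   = λ b≡ → a≢b (sym (trans b≡ j↦a))
    ... | inj₂ (j≢b , j↦j) = λ b≡ → j≢b (sym (trans b≡ j↦j))

    merge-b : merge b ≡ a
    merge-b with merge-cases b
    ... | inj₁ (_ , b↦a) = b↦a
    ... | inj₂ (b≢b , _) = ⊥-elim (b≢b refl)

    merge-a : merge a ≡ a
    merge-a with merge-cases a
    ... | inj₁ (a≡b , _) = ⊥-elim (a≢b a≡b)
    ... | inj₂ (_ , a↦a) = a↦a

    squash : Fin (suc k) → Fin k
    squash j = punchOut (b≢merge j)

    squash-cong : ∀ {j j′} → merge j ≡ merge j′ → squash j ≡ squash j′
    squash-cong = Fin.punchOut-cong b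

    squash-injective : ∀ {j j′} → squash j ≡ squash j′ → merge j ≡ merge j′
    squash-injective {j} {j′} = Fin.punchOut-injective (b≢merge j) (b≢merge j′)

    c₁ : Fin p → Fin k
    c₁ v = squash (c₂ (ψ v))

    c₂-u-w : merge (c₂ u) ≡ merge (c₂ w)
    c₂-u-w = trans merge-a (sym merge-b)

    ConnModulo⇒≡ : ∀ {x y} → ConnModulo Full F x y → merge (c₂ x) ≡ merge (c₂ y)
    ConnModulo⇒≡ (inj₁ c) = cong merge (Equivalence.from c₂-Conn c)
    ConnModulo⇒≡ (inj₂ (inj₁ (x~u , w~y))) = trans (cong merge (Equivalence.from c₂-Conn x~u))
      (trans c₂-u-w (cong merge (Equivalence.from c₂-Conn w~y)))
    ConnModulo⇒≡ (inj₂ (inj₂ (x~w , u~y))) = trans (cong merge (Equivalence.from c₂-Conn x~w))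
      (trans (sym c₂-u-w) (cong merge (Equivalence.from c₂-Conn u~y)))

    Conn-via-u : ∀ {x y} → c₂ x ≡ c₂ u → c₂ w ≡ c₂ y → Conn G₁ Full F (φ x) (φ y)
    Conn-via-u {y = y} x~u w~y = W₁.Conn-trans (Conn-φ-Full (Equivalence.to c₂-Conn x~u))
      (subst (λ v → Conn G₁ Full F v (φ y)) (sym φu≡φw) (Conn-φ-Full (Equivalence.to c₂-Conn w~y)))

    ≡⇒Conn : ∀ x y → merge (c₂ x) ≡ merge (c₂ y) → Conn G₁ Full F (φ x) (φ y)
    ≡⇒Conn x y eq with merge-cases (c₂ x) | merge-cases (c₂ y)
    ... | inj₁ (x~w , _)    | inj₁ (y~w , _)    =
      Conn-φ-Full (Equivalence.to c₂-Conn (trans x~w (sym y~w)))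
    ... | inj₁ (x~w , x↦a) | inj₂ (_ , y↦y)    =
      W₁.Conn-sym (Conn-via-u (trans (sym y↦y) (trans (sym eq) x↦a)) (sym x~w))
    ... | inj₂ (_ , x↦x)    | inj₁ (y~w , y↦a) = Conn-via-u (trans (sym x↦x) (trans eq y↦a)) (sym y~w)
    ... | inj₂ (_ , x↦x)    | inj₂ (_ , y↦y)    =
      Conn-φ-Full (Equivalence.to c₂-Conn (trans (sym x↦x) (trans eq y↦y)))

    c₁-φ : ∀ x → c₁ (φ x) ≡ squash (c₂ x)
    c₁-φ x with φ-identifies (ψ (φ x)) x (φ∘ψ (φ x))
    ... | inj₁ ψφx≡x             = cong (squash ∘ c₂) ψφx≡x
    ... | inj₂ (inj₁ (refl , refl)) = squash-cong {c₂ u} {c₂ w} c₂-u-w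
    ... | inj₂ (inj₂ (refl , refl)) = squash-cong {c₂ w} {c₂ u} (sym c₂-u-w)

    c₁-Conn : ∀ v v′ → c₁ v ≡ c₁ v′ ⇔ Conn G₁ Full F v v′
    c₁-Conn v v′ = mk⇔
      (λ eq → subst₂ (Conn G₁ Full F) (φ∘ψ v) (φ∘ψ v′)
                (≡⇒Conn (ψ v) (ψ v′) (squash-injective {c₂ (ψ v)} {c₂ (ψ v′)} eq)))
      (λ c → squash-cong {c₂ (ψ v)} {c₂ (ψ v′)}
               (ConnModulo⇒≡ (ConnModulo-Full (Conn-lift c (ψ v) (ψ v′) (φ∘ψ v) (φ∘ψ v′)))))

    surjective : ∀ i → ∃ λ v → c₁ v ≡ i
    surjective i with proj₁ (proj₂ H) (punchIn b i)
    ... | x , x↦i = φ x , (begin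
      c₁ (φ x)               ≡⟨ c₁-φ x ⟩
      squash (c₂ x)          ≡⟨ squash-cong {c₂ x} {punchIn b i} (cong merge x↦i) ⟩
      squash (punchIn b i)   ≡⟨ Fin.punchOut-cong b merge-punchIn ⟩
      punchOut (Fin.punchInᵢ≢i b i ∘ sym)   ≡⟨ Fin.punchOut-punchIn b ⟩
      i                      ∎)
      where
      open ≡-Reasoning
      merge-punchIn : merge (punchIn b i) ≡ punchIn b i
      merge-punchIn with merge-cases (punchIn b i)
      ... | inj₁ (i≡b , _)  = ⊥-elim (Fin.punchInᵢ≢i b i i≡b)
      ... | inj₂ (_ , i↦i) = i↦i

    result : HasComponents G₁ F k
    result = c₁ , surjective , c₁-Conn

  HasComponents₂⇒₁ : ∀ {F k} → HasComponents G₂ F (suc k) → HasComponents G₁ F k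
  HasComponents₂⇒₁ = MergeComponents.result

module Transfer {q p ne : ℕ} {G₂ : Graph q ne} {G₁ : Graph p ne} (I : Identification G₂ G₁) where
  open Identification I
  open Identified I
  module Swapped = Identified (Identification-swap I)

  tripartition₂⇒₁ : TripartitionsRealizedIn G₂ G₁
  tripartition₂⇒₁ T with u Sub.∈? Tripartition.comp T | w Sub.∈? Tripartition.comp T
  ... | yes u∈D | _        = realize-wlog₁ GlueTripartition.result T u∈D
  ... | no _    | yes w∈D = realize-wlog₁ Swapped.GlueTripartition.result T w∈D
  ... | no u∉D  | no w∉D  = ImageTripartition⇒Tripartition (ImageTripartition-avoiding T u∉D w∉D)

  ModularPair₁⇒₂ : ∀ {B₁ B₂} → ModularPair G₁ B₁ B₂ → ModularPair G₂ B₁ B₂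
  ModularPair₁⇒₂ (b₁ , b₂ , k , H∅ , H) =
    Bond₁⇒₂ b₁ , Bond₁⇒₂ b₂ , suc k , HasComponents₁⇒₂ H∅ , HasComponents₁⇒₂ H

  ModularPair₂⇒₁ : ∀ {B₁ B₂} → ModularPair G₂ B₁ B₂ → ModularPair G₁ B₁ B₂
  ModularPair₂⇒₁ (_ , _ , zero , (label , _) , _) with label u
  ... | ()
  ModularPair₂⇒₁ (b₁ , b₂ , suc k , H∅ , H) =
    Bond₂⇒₁ b₁ , Bond₂⇒₁ b₂ , k , HasComponents₂⇒₁ H∅ , HasComponents₂⇒₁ H

  Tribond₁⇒₂ : ∀ {D} → Tribond G₁ D → Tribond G₂ D
  Tribond₁⇒₂ = Tribond-transfer tripartition₁⇒₂

  Tribond₂⇒₁ : ∀ {D} → Tribond G₂ D → Tribond G₁ D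
  Tribond₂⇒₁ = Tribond-transfer tripartition₂⇒₁

  LinearClass⇔ : ∀ ℒ → LinearClass G₁ ℒ ⇔ LinearClass G₂ ℒ
  LinearClass⇔ ℒ = mk⇔ (LinearClass-transfer Bond₁⇒₂ tripartition₂⇒₁)
                       (LinearClass-transfer Bond₂⇒₁ tripartition₁⇒₂)

  J₀Cocircuit⇔ : ∀ ℒ D → J₀Cocircuit G₁ ℒ D ⇔ J₀Cocircuit G₂ ℒ D
  J₀Cocircuit⇔ ℒ D = mk⇔
    (J₀Cocircuit-transfer Bond₁⇒₂ Bond₂⇒₁ tripartition₁⇒₂ (Dibond-transfer ModularPair₁⇒₂ Tribond₂⇒₁))
    (J₀Cocircuit-transfer Bond₂⇒₁ Bond₁⇒₂ tripartition₂⇒₁ (Dibond-transfer ModularPair₂⇒₁ Tribond₁⇒₂))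

-- The shared-vertex union is the disjoint union with two vertices identified

splitAt-cases : ∀ {m n} (P : Fin (m + n) → Set) → (∀ e → P (e ↑ˡ n)) → (∀ e → P (m ↑ʳ e)) → ∀ e → P e
splitAt-cases {m} P left right e with splitAt m e in eq
... | inj₁ e′ = subst P (Fin.splitAt⁻¹-↑ˡ eq) (left e′)
... | inj₂ e′ = subst P (Fin.splitAt⁻¹-↑ʳ eq) (right e′)

module FromUnions {a b m n p q : ℕ} {H : Graph a m} {K : Graph b n}
                  {G₁ : Graph p (m + n)} {G₂ : Graph q (m + n)}
                  (sv : SharedVertexUnion H K G₁) (du : DisjointUnion H K G₂) where
  module U₁ = UnionData (SharedVertexUnion.union sv)
  module U₂ = UnionData (DisjointUnion.union du)
  open SharedVertexUnion sv using (x₀; y₀; shared; unique)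
  open DisjointUnion du using (disj)

  Origin₂ : Fin q → Set
  Origin₂ v = (∃ λ x → U₂.fH x ≡ v) ⊎ (∃ λ y → U₂.fK y ≡ v)

  Origin₁ : Fin p → Set
  Origin₁ v = (∃ λ x → U₁.fH x ≡ v) ⊎ (∃ λ y → U₁.fK y ≡ v)

  φ-from : ∀ {v} → Origin₂ v → Fin p
  φ-from (inj₁ (x , _)) = U₁.fH x
  φ-from (inj₂ (y , _)) = U₁.fK y

  side-from : ∀ {v} → Origin₂ v → Bool
  side-from (inj₁ _) = true
  side-from (inj₂ _) = false

  ψ-from : ∀ {v} → Origin₁ v → Fin q
  ψ-from (inj₁ (x , _)) = U₂.fH x
  ψ-from (inj₂ (y , _)) = U₂.fK y

  φ : Fin q → Fin p
  φ v = φ-from (U₂.cover v)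

  ψ : Fin p → Fin q
  ψ v = ψ-from (U₁.cover v)

  side : Fin q → Bool
  side v = side-from (U₂.cover v)

  -- in the disjoint union every vertex has exactly one origin
  φ-fH : ∀ x → φ (U₂.fH x) ≡ U₁.fH x
  φ-fH x = from (U₂.cover (U₂.fH x))
    where
    from : (o : Origin₂ (U₂.fH x)) → φ-from o ≡ U₁.fH x
    from (inj₁ (x′ , eq)) = cong U₁.fH (U₂.injH eq)
    from (inj₂ (y , eq))  = ⊥-elim (disj x y (sym eq))

  φ-fK : ∀ y → φ (U₂.fK y) ≡ U₁.fK y
  φ-fK y = from (U₂.cover (U₂.fK y))
    where
    from : (o : Origin₂ (U₂.fK y)) → φ-from o ≡ U₁.fK y
    from (inj₁ (x , eq))  = ⊥-elim (disj x y eq)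
    from (inj₂ (y′ , eq)) = cong U₁.fK (U₂.injK eq)

  side-fH : ∀ x → side (U₂.fH x) ≡ true
  side-fH x = from (U₂.cover (U₂.fH x))
    where
    from : (o : Origin₂ (U₂.fH x)) → side-from o ≡ true
    from (inj₁ _)        = refl
    from (inj₂ (y , eq)) = ⊥-elim (disj x y (sym eq))

  side-fK : ∀ y → side (U₂.fK y) ≡ false
  side-fK y = from (U₂.cover (U₂.fK y))
    where
    from : (o : Origin₂ (U₂.fK y)) → side-from o ≡ false
    from (inj₁ (x , eq)) = ⊥-elim (disj x y eq)
    from (inj₂ _)        = refl

  φ∘ψ : ∀ v → φ (ψ v) ≡ v
  φ∘ψ v = from (U₁.cover v)
    where
    from : (o : Origin₁ v) → φ (ψ-from o) ≡ v
    from (inj₁ (x , eq)) = trans (φ-fH x) eq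
    from (inj₂ (y , eq)) = trans (φ-fK y) eq

  u w : Fin q
  u = U₂.fH x₀
  w = U₂.fK y₀

  φ-identifies : ∀ x y → φ x ≡ φ y → x ≡ y ⊎ (x ≡ u × y ≡ w) ⊎ (x ≡ w × y ≡ u)
  φ-identifies x y = by-origin (U₂.cover x) (U₂.cover y)
    where
    by-origin : Origin₂ x → Origin₂ y → φ x ≡ φ y → x ≡ y ⊎ (x ≡ u × y ≡ w) ⊎ (x ≡ w × y ≡ u)
    by-origin (inj₁ (x′ , refl)) (inj₁ (y′ , refl)) eq =
      inj₁ (cong U₂.fH (U₁.injH (trans (sym (φ-fH x′)) (trans eq (φ-fH y′)))))
    by-origin (inj₁ (x′ , refl)) (inj₂ (y′ , refl)) eq =
      let x′≡x₀ , y′≡y₀ = unique x′ y′ (trans (sym (φ-fH x′)) (trans eq (φ-fK y′))) in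
      inj₂ (inj₁ (cong U₂.fH x′≡x₀ , cong U₂.fK y′≡y₀))
    by-origin (inj₂ (x′ , refl)) (inj₁ (y′ , refl)) eq =
      let y′≡x₀ , x′≡y₀ = unique y′ x′ (trans (sym (φ-fH y′)) (trans (sym eq) (φ-fK x′))) in
      inj₂ (inj₂ (cong U₂.fK x′≡y₀ , cong U₂.fH y′≡x₀))
    by-origin (inj₂ (x′ , refl)) (inj₂ (y′ , refl)) eq =
      inj₁ (cong U₂.fK (U₁.injK (trans (sym (φ-fK x′)) (trans eq (φ-fK y′)))))

  ends-φ : ∀ e → Graph.ends G₁ e ≡ mapPair φ (Graph.ends G₂ e)
  ends-φ = splitAt-cases (λ e → Graph.ends G₁ e ≡ mapPair φ (Graph.ends G₂ e))
    (λ e → trans (U₁.endsH e)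
             (trans (mapPair-via φ-fH (Graph.ends H e)) (cong (mapPair φ) (sym (U₂.endsH e)))))
    (λ e → trans (U₁.endsK e)
             (trans (mapPair-via φ-fK (Graph.ends K e)) (cong (mapPair φ) (sym (U₂.endsK e)))))
    where
    mapPair-via : ∀ {c} {f₁ : Fin c → Fin p} {f₂ : Fin c → Fin q} → (∀ x → φ (f₂ x) ≡ f₁ x) →
                  ∀ ends → mapPair f₁ ends ≡ mapPair φ (mapPair f₂ ends)
    mapPair-via eq (s , t) = cong₂ _,_ (sym (eq s)) (sym (eq t))

  side-edge : ∀ e → side (src G₂ e) ≡ side (tgt G₂ e)
  side-edge = splitAt-cases (λ e → side (src G₂ e) ≡ side (tgt G₂ e))
    (λ e → subst (λ ends → side (proj₁ ends) ≡ side (proj₂ ends)) (sym (U₂.endsH e))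
                 (trans (side-fH _) (sym (side-fH _))))
    (λ e → subst (λ ends → side (proj₁ ends) ≡ side (proj₂ ends)) (sym (U₂.endsK e))
                 (trans (side-fK _) (sym (side-fK _))))

  identification : Identification G₂ G₁
  identification = record
    { φ = φ ; ψ = ψ ; u = u ; w = w ; side = side
    ; src-φ = λ e → cong proj₁ (ends-φ e) ; tgt-φ = λ e → cong proj₂ (ends-φ e)
    ; φ∘ψ = φ∘ψ ; φ-identifies = φ-identifies
    ; φu≡φw = trans (φ-fH x₀) (trans shared (sym (φ-fK y₀)))
    ; side-edge = side-edge ; side-u = side-fH x₀ ; side-w = side-fK y₀ }

theorem3p12 : {a b m n p q : ℕ} (H : Graph a m) (K : Graph b n)
    (G₁ : Graph p (m + n)) (G₂ : Graph q (m + n)) →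
    SharedVertexUnion H K G₁ → DisjointUnion H K G₂ →
    (∀ (ℒ : Subset (m + n) → Set) → LinearClass G₁ ℒ ⇔ LinearClass G₂ ℒ)
    × (∀ (ℒ : Subset (m + n) → Set) → LinearClass G₁ ℒ →
         (∀ D → J₀Cocircuit G₁ ℒ D ⇔ J₀Cocircuit G₂ ℒ D)
         × (∀ D → JCocircuit G₁ ℒ D ⇔ JCocircuit G₂ ℒ D))
-- the equality of the J₀-cocircuits holds for every ℒ
theorem3p12 H K G₁ G₂ sv du =
  LinearClass⇔ , λ ℒ _ → J₀Cocircuit⇔ ℒ , λ D → J₀Cocircuit⇔ ℒ (false ∷ D)
  where open Transfer (FromUnions.identification sv du)
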